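{- Let $v$ be any starting node of the ring of size $n$. Every exploration algorithm (not knowing the fault configuration) for the ring starting at $v$ has overhead at least: $\frac{2n-3}{n}$ for $4\leq n\leq 5$; $\frac{3}{2}$ for $6\leq n\leq 7$; $\frac{2n-2}{n+1}$ for $8\leq n\leq 19$; $\frac{9}{5}$ for $20\leq n\leq 23$; $\frac{2n-1}{n+2}$ for $n\geq 24$.
   Context: Exploration model: a graph is simple, connected, undirected, with distinct node labels and ports $1,\dots,d$ at each node of degree $d$. A mobile agent starts at node $v$ with a complete labeled map of the graph with $v$ marked. A fault configuration is a set $F$ of faulty edges, unknown to the agent; faulty edges cannot be traversed, and on first visiting a node the agent learns which incident ports are faulty. $C$ is the connected component of $v$ in the graph with faulty edges removed; an exploration algorithm (deterministic) must visit all nodes of $C$, and exploration is finished when the last node of $C$ is visited. The cost $\mathcal{C}(A,F)$ is the number of edge traversals; $opt(F)$ is the minimum number of traversals needed to visit all nodes of $C$ from $v$ by an agent knowing $F$; the overhead is $\mathcal{O}_A=\max_{F} \mathcal{C}(A,F)/opt(F)$ over all fault configurations $F$ (ratio $1$ when $C=\{v\}$). The ring of size $n\ge 3$ has nodes $v_1,\dots,v_n$ and edges $\{v_i,v_{i+1}\}$ ($1\le i\le n-1$) and $\{v_n,v_1\}$. -}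

module Defs where

open import Data.Nat using (ℕ; zero; suc; _+_; _*_; _∸_; _≤_; _<_; NonZero)
open import Data.Nat.DivMod using (_%_; m%n<n)
open import Data.Fin using (Fin; toℕ; fromℕ<)
open import Data.Bool using (Bool; true; false)
open import Data.List using (List; []; _∷_; length; reverse)
open import Data.List.Membership.Propositional using (_∈_)
open import Data.Product using (_×_; _,_; ∃; ∃-syntax)
open import Relation.Binary.PropositionalEquality using (_≡_)

-- Ring of size n: nodes v_1..v_n are represented by Fin n (v_{i+1} ↦ i).
-- Edge e_i = {v_i, v_{i+1 mod n}} is represented by the index of v_i.

data Dir : Set where
  cw ccw : Dir

module _ {n : ℕ} .{{_ : NonZero n}} where

  succR : Fin n → Fin n
  succR i = fromℕ< (m%n<n (suc (toℕ i)) n)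

  predR : Fin n → Fin n
  predR i = fromℕ< (m%n<n (toℕ i + (n ∸ 1)) n)

  move : Fin n → Dir → Fin n
  move u cw  = succR u
  move u ccw = predR u

  edgeOf : Fin n → Dir → Fin n
  edgeOf u cw  = u
  edgeOf u ccw = predR u

-- Fault configuration: F e ≡ true iff edge e is faulty.
FaultConf : ℕ → Set
FaultConf n = Fin n → Bool

-- What the agent learns at a node: faultiness of its cw edge and of its ccw edge.
Obs : Set
Obs = Bool × Bool

-- A deterministic exploration algorithm: the next move as a function of the
-- full history of observations (most recent first).  The agent knows the map
-- and its start, hence its position is determined by its own past moves.
Algorithm : Set
Algorithm = List Obs → Dir

module _ {n : ℕ} .{{_ : NonZero n}} where

  obs : FaultConf n → Fin n → Obs
  obs F u = F (edgeOf u cw) , F (edgeOf u ccw)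

  data ValidWalk (F : FaultConf n) : Fin n → List Dir → Set where
    []  : ∀ {u} → ValidWalk F u []
    _∷_ : ∀ {u d ds} → F (edgeOf u d) ≡ false →
          ValidWalk F (move u d) ds → ValidWalk F u (d ∷ ds)

  visited : Fin n → List Dir → List (Fin n)
  visited u []       = u ∷ []
  visited u (d ∷ ds) = u ∷ visited (move u d) ds

  -- u belongs to C, the component of v in the ring with faulty edges removed
  InC : FaultConf n → Fin n → Fin n → Set
  InC F v u = ∃[ ds ] (ValidWalk F v ds × u ∈ visited v ds)

  Covers : FaultConf n → Fin n → List Dir → Set
  Covers F v ds = ValidWalk F v ds × (∀ u → InC F v u → u ∈ visited v ds)

  IsOpt : FaultConf n → Fin n → ℕ → Set
  IsOpt F v m = (∃[ ds ] (length ds ≡ m × Covers F v ds))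
              × (∀ ds → Covers F v ds → m ≤ length ds)

  record State : Set where
    constructor st
    field
      pos   : Fin n
      hist  : List Obs
      moves : List Dir   -- most recent first

  open State public

  run : Algorithm → FaultConf n → Fin n → ℕ → State
  run A F v zero = st v (obs F v ∷ []) []
  run A F v (suc k) with run A F v k
  ... | st p h ms = st (move p (A h)) (obs F (move p (A h)) ∷ h) (A h ∷ ms)

  runMoves : Algorithm → FaultConf n → Fin n → ℕ → List Dir
  runMoves A F v k = reverse (moves (run A F v k))

  -- Overhead of A (from v) is at least p/q: there is a fault configuration F
  -- with opt(F) = m > 0 such that the cost C(A,F) (the first k at which the
  -- first k moves are all traversable and have visited all of C) satisfies
  -- C(A,F)/opt(F) ≥ p/q.  (If A never finishes on F the cost is infinite.)
  OverheadAtLeast : Fin n → Algorithm → ℕ → ℕ → Set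
  OverheadAtLeast v A p q =
    ∃[ F ] ∃[ m ] (IsOpt F v m × 0 < m ×
      (∀ k → Covers F v (runMoves A F v k) → p * m ≤ q * k))

-- The proof is an adversary argument.  Run A on the fault-free ring and record
-- its positions as a walk on ℕ that starts at K (large) and moves by ±1.  By
-- symmetry the first move is clockwise.  The adversary then picks an arc
-- [K - L, K + R] of the walk (a path of the ring containing v, L steps
-- counterclockwise and R steps clockwise) in at most three rounds, watching
-- where the walk first leaves the arc it currently proposes; the final arc is
-- a "trap": the walk needs B steps to visit both of its ends, with
-- p/q · (L + R + min(L, R)) ≤ B.  Cutting the two ring edges just outside the
-- arc gives a fault configuration whose optimal exploration cost is
-- L + R + min(L, R) and which A cannot tell apart from the fault-free ring
-- until it reaches an end of the arc, so A pays at least B.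

module Submission where

open import Defs
open import Data.Nat
open import Data.Nat.Properties
open import Data.Nat.DivMod using (_%_; _/_; m%n<n; m%n≤n; m%n%n≡m%n; %-distribˡ-+; [m+n]%n≡m%n; [m+kn]%n≡m%n; m<n⇒m%n≡m; m≡m%n+[m/n]*n)
open import Data.Nat.Tactic.RingSolver using (solve; solve-∀)
open import Data.Fin using (Fin; toℕ)
open import Data.Fin.Properties using (toℕ-fromℕ<; toℕ<n; toℕ-injective)
open import Data.Bool using (Bool; false; _∨_)
open import Data.Bool.Properties using (∨-conicalˡ; ∨-conicalʳ)
open import Data.Product using (Σ; _×_; _,_; proj₁; proj₂)
import Data.Product
open import Data.Sum using (_⊎_; inj₁; inj₂; [_,_]′)
import Data.Sum
open import Data.Empty using (⊥-elim)
open import Data.List using (List; []; _∷_; _++_; length; replicate; [_])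
open import Data.List.Properties using (unfold-reverse; length-++; length-replicate)
open import Data.List.Membership.Propositional using (_∈_)
open import Data.List.Relation.Unary.Any using (here; there)
open import Function using (_∘_)
open import Relation.Nullary using (¬_; Dec; yes; no; contradiction)
open import Relation.Nullary.Decidable using (True; toWitness; dec-true; dec-false; does)
open import Relation.Binary.PropositionalEquality hiding ([_])

cancel-common : ∀ {X Y C A B : ℕ} → A ≤ B → X + C ≡ A → B ≡ Y + C → X ≤ Y
cancel-common {X} {Y} {C} A≤B refl refl = +-cancelʳ-≤ C X Y A≤B

add-right : ∀ {X T} Z {Y} → X + Z ≡ Y → X ≤ T → Y ≤ T + Z
add-right Z refl X≤T = +-monoˡ-≤ Z X≤T

-- The walk stands at K + X at some time and at K - y (written W + y ≡ K) at
-- another; a Lipschitz bound V + Z ≤ W + Y between them becomes a time bound.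
span-bound : ∀ {K W V X Y Z} y → W + y ≡ K → V ≡ K + X → V + Z ≤ W + Y → X + Z + y ≤ Y
span-bound {.(W + y)} {W} {.(W + y + X)} {X} {Y} {Z} y refl refl h =
  +-cancelˡ-≤ W (X + Z + y) Y (subst (_≤ W + Y) regroup h)
  where regroup : W + y + X + Z ≡ W + (X + Z + y)
        regroup = solve (W ∷ y ∷ X ∷ Z ∷ [])

ratio-two : ∀ {p} q {m B} → p ≤ q + q → m + m ≤ B → p * m ≤ q * B
ratio-two {p} q {m} {B} p≤2q 2m≤B =
  ≤-trans (*-monoˡ-≤ m p≤2q) (subst (_≤ q * B) regroup (*-monoʳ-≤ q 2m≤B))
  where regroup : q * (m + m) ≡ (q + q) * m
        regroup = solve (q ∷ m ∷ [])

∸-step : ∀ M x y → y ≤ suc x → M ∸ x ≤ suc (M ∸ y)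
∸-step zero    x       y       _           rewrite 0∸n≡0 x = z≤n
∸-step (suc M) zero    zero    _           = n≤1+n _
∸-step (suc M) zero    (suc zero) _        = ≤-refl
∸-step (suc M) zero    (suc (suc y)) (s≤s ())
∸-step (suc M) (suc x) zero    _           = ≤-trans (m∸n≤m M x) (≤-trans (n≤1+n M) (n≤1+n (suc M)))
∸-step (suc M) (suc x) (suc y) y≤1+x       = ∸-step M x y (≤-pred y≤1+x)

first-within : (P : ℕ → Set) → (∀ t → Dec (P t)) → ∀ N →
  (Σ ℕ λ T → T ≤ N × P T × (∀ t → t < T → ¬ P t)) ⊎ (∀ t → t ≤ N → ¬ P t)
first-within P P? zero with P? 0
... | yes p = inj₁ (0 , z≤n , p , λ t ())
... | no ¬p = inj₂ λ { .0 z≤n → ¬p }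
first-within P P? (suc N) with first-within P P? N
... | inj₁ (T , T≤N , p , before) = inj₁ (T , m≤n⇒m≤1+n T≤N , p , before)
... | inj₂ none with P? (suc N)
...   | yes p = inj₁ (suc N , ≤-refl , p , λ t t≤N → none t (≤-pred t≤N))
...   | no ¬p = inj₂ λ t t≤1+N → [ (λ t≤N → none t (≤-pred t≤N)) , (λ { refl → ¬p }) ]′ (m≤n⇒m<n∨m≡n t≤1+N)

extremum : {_≼_ : ℕ → ℕ → Set} → (∀ {x} → x ≼ x) → (∀ {x y z} → x ≼ y → y ≼ z → x ≼ z) →
  (∀ x y → x ≼ y ⊎ y ≼ x) → (f : ℕ → ℕ) → ∀ T → Σ ℕ λ t₀ → t₀ ≤ T × (∀ t → t ≤ T → f t ≼ f t₀)
extremum refl′ _ _ f zero = 0 , z≤n , λ { .0 z≤n → refl′ }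
extremum {_≼_} refl′ trans′ total f (suc T) with extremum refl′ trans′ total f T
... | t₀ , t₀≤T , best with total (f (suc T)) (f t₀)
...   | inj₁ le = t₀ , m≤n⇒m≤1+n t₀≤T , λ t t≤1+T →
          [ (λ t<1+T → best t (≤-pred t<1+T)) , (λ { refl → le }) ]′ (m≤n⇒m<n∨m≡n t≤1+T)
...   | inj₂ ge = suc T , ≤-refl , λ t t≤1+T →
          [ (λ t<1+T → trans′ (best t (≤-pred t<1+T)) ge) , (λ { refl → refl′ }) ]′ (m≤n⇒m<n∨m≡n t≤1+T)

argmax : (f : ℕ → ℕ) → ∀ T → Σ ℕ λ t₀ → t₀ ≤ T × (∀ t → t ≤ T → f t ≤ f t₀)
argmax = extremum ≤-refl ≤-trans ≤-total

argmin : (f : ℕ → ℕ) → ∀ T → Σ ℕ λ t₀ → t₀ ≤ T × (∀ t → t ≤ T → f t ≥ f t₀)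
argmin = extremum ≤-refl (λ x≥y y≥z → ≤-trans y≥z x≥y) (λ x y → Data.Sum.swap (≤-total x y))

module Lipschitz (f : ℕ → ℕ) (K : ℕ)
  (step-up : ∀ t → t < K → f (suc t) ≤ suc (f t))
  (step-down : ∀ t → t < K → f t ≤ suc (f (suc t))) where

  rise-bound : ∀ {t t'} → t ≤ t' → t' ≤ K → f t' + t ≤ f t + t'
  rise-bound {t} {t'} t≤t' _ with m≤n⇒m<n∨m≡n t≤t'
  ... | inj₂ refl = ≤-refl
  rise-bound {t} {suc s} _ s<K | inj₁ t<1+s = begin
    f (suc s) + t   ≤⟨ +-monoˡ-≤ t (step-up s s<K) ⟩
    suc (f s + t)   ≤⟨ s≤s (rise-bound (≤-pred t<1+s) (<⇒≤ s<K)) ⟩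
    suc (f t + s)   ≡⟨ sym (+-suc (f t) s) ⟩
    f t + suc s     ∎
    where open ≤-Reasoning

  fall-bound : ∀ {t t'} → t ≤ t' → t' ≤ K → f t + t ≤ f t' + t'
  fall-bound {t} {t'} t≤t' _ with m≤n⇒m<n∨m≡n t≤t'
  ... | inj₂ refl = ≤-refl
  fall-bound {t} {suc s} _ s<K | inj₁ t<1+s = begin
    f t + t             ≤⟨ fall-bound (≤-pred t<1+s) (<⇒≤ s<K) ⟩
    f s + s             ≤⟨ +-monoˡ-≤ s (step-down s s<K) ⟩
    suc (f (suc s) + s) ≡⟨ sym (+-suc (f (suc s)) s) ⟩
    f (suc s) + suc s   ∎
    where open ≤-Reasoning

-- A walk w : ℕ → ℕ starts at w 0 = K; K is large enough that
-- the walk never reaches 0 within the K steps we look at.  The arc of the walk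
-- with parameters L, R is the range [K - L, K + R] of positions.

UnitSteps : (ℕ → ℕ) → ℕ → Set
UnitSteps w K = ∀ t → t < K → w (suc t) ≡ suc (w t) ⊎ suc (w (suc t)) ≡ w t

Inside : (ℕ → ℕ) → ℕ → ℕ → ℕ → ℕ → Set
Inside w K L R t = K < w t + L × w t < K + R

AtEnd : (ℕ → ℕ) → ℕ → ℕ → ℕ → ℕ → Set
AtEnd w K L R t = w t ≡ K + R ⊎ w t + L ≡ K

-- B is a lower bound on the time needed to visit both ends of the arc: either
-- the walk first reaches an end at time T and still has L + R steps to go, or
-- it stays inside the arc for the first B ≤ K steps.
data ForcedCost (w : ℕ → ℕ) (K L R B : ℕ) : Set where
  end-then-cross : ∀ T → T ≤ K → (∀ t → t < T → Inside w K L R t) → AtEnd w K L R T →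
                   B ≤ T + (L + R) → ForcedCost w K L R B
  stays-inside   : B ≤ K → (∀ t → t < B → Inside w K L R t) → ForcedCost w K L R B

module Walk (w : ℕ → ℕ) (K : ℕ) (unit : UnitSteps w K) (w0 : w 0 ≡ K) where

  step-up : ∀ t → t < K → w (suc t) ≤ suc (w t)
  step-up t t<K = [ ≤-reflexive , (λ e → ≤-trans (n≤1+n _) (≤-trans (≤-reflexive e) (n≤1+n _))) ]′ (unit t t<K)

  step-down : ∀ t → t < K → w t ≤ suc (w (suc t))
  step-down t t<K = [ (λ e → ≤-trans (n≤1+n _) (≤-trans (≤-reflexive (sym e)) (n≤1+n _))) , (≤-reflexive ∘ sym) ]′ (unit t t<K)

  open Lipschitz w K step-up step-down public

  height≤time : ∀ {T} → T ≤ K → w T ≤ K + T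
  height≤time {T} T≤K = subst₂ _≤_ (+-identityʳ (w T)) (cong (_+ T) w0) (rise-bound z≤n T≤K)

  at-end? : ∀ L R t → Dec (AtEnd w K L R t)
  at-end? L R t with w t ≟ K + R | w t + L ≟ K
  ... | yes e | _     = yes (inj₁ e)
  ... | no _  | yes e = yes (inj₂ e)
  ... | no ¬r | no ¬l = no [ ¬r , ¬l ]′

  stay-inside : ∀ L R t → t < K → Inside w K L R t → ¬ AtEnd w K L R (suc t) → Inside w K L R (suc t)
  stay-inside L R t t<K (left , right) ¬end with unit t t<K
  ... | inj₁ e rewrite e = ≤-trans left (n≤1+n _) , ≤∧≢⇒< right (¬end ∘ inj₁)
  ... | inj₂ e = ≤∧≢⇒< (≤-pred (subst (λ x → K < x + L) (sym e) left)) (¬end ∘ inj₂ ∘ sym) ,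
                 <-trans (subst (w (suc t) <_) e ≤-refl) right

  inside-until : ∀ L R → 1 ≤ L → 1 ≤ R → ∀ T → T ≤ K → (∀ t → t < T → ¬ AtEnd w K L R t) →
                 ∀ t → t < T → Inside w K L R t
  inside-until L R L≥1 R≥1 T T≤K ¬end zero _ =
    subst (λ x → K < x + L) (sym w0) (≤-trans (≤-reflexive (+-comm 1 K)) (+-monoʳ-≤ K L≥1)) ,
    subst (_< K + R) (sym w0) (≤-trans (≤-reflexive (+-comm 1 K)) (+-monoʳ-≤ K R≥1))
  inside-until L R L≥1 R≥1 T T≤K ¬end (suc t) 1+t<T =
    stay-inside L R t (<-≤-trans (<-trans (n<1+n t) 1+t<T) T≤K)
      (inside-until L R L≥1 R≥1 T T≤K ¬end t (<-trans (n<1+n t) 1+t<T)) (¬end (suc t) 1+t<T)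

  data FirstExit (L R : ℕ) : Set where
    exits-right : ∀ T → T ≤ K → (∀ t → t < T → Inside w K L R t) → w T ≡ K + R → FirstExit L R
    exits-left  : ∀ T → T ≤ K → (∀ t → t < T → Inside w K L R t) → w T + L ≡ K → FirstExit L R
    never-exits : (∀ t → t < K → Inside w K L R t) → FirstExit L R

  first-exit : ∀ L R → 1 ≤ L → 1 ≤ R → FirstExit L R
  first-exit L R L≥1 R≥1 with first-within (AtEnd w K L R) (at-end? L R) K
  ... | inj₁ (T , T≤K , inj₁ e , before) = exits-right T T≤K (inside-until L R L≥1 R≥1 T T≤K before) e
  ... | inj₁ (T , T≤K , inj₂ e , before) = exits-left T T≤K (inside-until L R L≥1 R≥1 T T≤K before) e
  ... | inj₂ none = never-exits (inside-until L R L≥1 R≥1 K ≤-refl (λ t t<K → none t (<⇒≤ t<K)))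

  record Peak (T x : ℕ) : Set where
    field
      top t-top : ℕ
      t-top≤T   : t-top ≤ T
      w-top     : w t-top ≡ K + top
      x≤top     : x ≤ top
      below-top : ∀ t → t ≤ T → w t ≤ K + top

  peak : ∀ T x s → s ≤ T → K + x ≤ w s → Peak T x
  peak T x s s≤T high with argmax w T
  ... | ta , ta≤T , max = record
    { top = w ta ∸ K ; t-top = ta ; t-top≤T = ta≤T ; w-top = sym K+a≡
    ; x≤top = +-cancelˡ-≤ K x _ (subst (K + x ≤_) (sym K+a≡) reach)
    ; below-top = λ t t≤T → subst (w t ≤_) (sym K+a≡) (max t t≤T) }
    where
      reach : K + x ≤ w ta
      reach = ≤-trans high (max s s≤T)
      K+a≡ : K + (w ta ∸ K) ≡ w ta
      K+a≡ = m+[n∸m]≡n (≤-trans (m≤m+n K x) reach)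

  record Trough (T x : ℕ) : Set where
    field
      depth t-bot : ℕ
      t-bot≤T     : t-bot ≤ T
      w-bot       : w t-bot + depth ≡ K
      x≤depth     : x ≤ depth
      above-bot   : ∀ t → t ≤ T → w t-bot ≤ w t

  trough : ∀ T x s → s ≤ T → w s + x ≤ K → Trough T x
  trough T x s s≤T low with argmin w T
  ... | tb , tb≤T , min = record
    { depth = K ∸ w tb ; t-bot = tb ; t-bot≤T = tb≤T ; w-bot = tb+b≡
    ; x≤depth = +-cancelˡ-≤ (w tb) x _ (subst (w tb + x ≤_) (sym tb+b≡) reach)
    ; above-bot = min }
    where
      reach : w tb + x ≤ K
      reach = ≤-trans (+-monoˡ-≤ x (min s s≤T)) low
      tb+b≡ : w tb + (K ∸ w tb) ≡ K
      tb+b≡ = m+[n∸m]≡n (≤-trans (m≤m+n (w tb) x) reach)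

-- The adversary works on the ring of size n = k + 3.  The inequalities it
-- needs for a target ratio p/q are collected in the records below.

-- Conditions for the rounds two and three, used when the first turn of the
-- walk happened after a short excursion of length a ∈ {1, 2}.
record LongGame (k p q a : ℕ) : Set where
  field
    room   : 5 ≤ k
    second : p * (k + 3 + a) ≤ q * (k + k + a + 3)
    third  : ∀ b → 1 ≤ b → b ≤ 2 → p * (k + 3 + b) ≤ q * (k + k + b + 5)

-- A ratio p/q is admissible when it is at most 2, achieved if the walk runs
-- straight into the far end in round one, and for short excursions either
-- achieved at once or by the rounds two and three.
record Rate (k p q : ℕ) : Set where
  field
    at-most-two : p ≤ q + q
    first-round : p * (k + 3) ≤ q * (k + k + 3)
    short-turn  : ∀ a → 1 ≤ a → a ≤ 2 → p * (a + 3) ≤ q * (a + a + a + 3) ⊎ LongGame k p q a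

-- An arc [K - L, K + R] with at most k + 2 edges (so it is a path in the ring
-- of size k + 3) and a cost B forced by the walk on it, at least p/q times the
-- optimal exploration cost L + R + min(L, R) of the arc from K.
record Trap (w : ℕ → ℕ) (K k p q : ℕ) : Set where
  constructor trap
  field
    L R B  : ℕ
    L≥1    : 1 ≤ L
    R≥1    : 1 ≤ R
    fits   : suc (L + R) ≤ 3 + k
    ratio  : p * (L + R + L ⊓ R) ≤ q * B
    forced : ForcedCost w K L R B

-- Given a walk that starts at K and first steps to the right, the adversary
-- builds a trap by at most three rounds: in each round it proposes an arc of
-- k + 2 edges and watches where the walk first leaves it.  If the walk runs
-- into the far end, that arc is the trap; if it turns back, the adversary
-- shrinks the arc on the side the walk came from to just beyond the furthest
-- point it reached there, which makes the walk's detour expensive.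
module Adversary (w : ℕ → ℕ) (K : ℕ) (unit : UnitSteps w K) (w0 : w 0 ≡ K) (w1 : w 1 ≡ suc K)
  {k p q : ℕ} (K-large : k + k + k + k + 8 ≤ K) (rate : Rate k p q) where

  open Walk w K unit w0
  open Rate rate

  ratio-K : ∀ L R → L + R ≤ 2 + k → p * (L + R + L ⊓ R) ≤ q * K
  ratio-K L R L+R≤ = ratio-two q at-most-two (≤-trans (subst (L + R + L ⊓ R + (L + R + L ⊓ R) ≤_) regroup (+-mono-≤ opt≤ opt≤)) K-large)
    where
      opt≤ : L + R + L ⊓ R ≤ 2 + k + (2 + k)
      opt≤ = +-mono-≤ L+R≤ (≤-trans (m⊓n≤m L R) (≤-trans (m≤m+n L R) L+R≤))
      regroup : 2 + k + (2 + k) + (2 + k + (2 + k)) ≡ k + k + k + k + 8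
      regroup = solve (k ∷ [])

  never-exiting : ∀ L R → 1 ≤ L → 1 ≤ R → suc (L + R) ≤ 3 + k → (∀ t → t < K → Inside w K L R t) → Trap w K k p q
  never-exiting L R L≥1 R≥1 fits inside = trap L R K L≥1 R≥1 fits (ratio-K L R (≤-pred fits)) (stays-inside ≤-refl inside)

  -- The walk went right to K + a, turned at K - 1, went down to
  -- its minimum K - b at time tb (b ≤ 2) and then reached K + a + 1 at time
  -- T2.  The adversary proposes the arc [K - b - 1, K + i] with i + b = k + 1.
  module Round₃ (a : ℕ) (a≥1 : 1 ≤ a) (a≤2 : a ≤ 2) (long : LongGame k p q a)
                (b : ℕ) (b≥1 : 1 ≤ b) (b≤2 : b ≤ 2)
                (T2 : ℕ) (T2≤K : T2 ≤ K) (at-T2 : w T2 ≡ K + suc a)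
                (below-T2 : ∀ t → t < T2 → w t < K + suc a)
                (tb : ℕ) (tb<T2 : tb < T2) (at-tb : w tb + b ≡ K)
                (lowest : ∀ t → t < T2 → w tb ≤ w t) (tb-late : a + a + b ≤ tb) where

    open LongGame long

    i : ℕ
    i = suc k ∸ b

    i+b≡ : i + b ≡ suc k
    i+b≡ = m∸n+n≡m (≤-trans b≤2 (≤-trans (s≤s (s≤s z≤n)) (≤-trans room (n≤1+n k))))

    -- Since k ≥ 5 the right part i of the arc exceeds both a and b.
    i-large : ∀ {x} → x ≤ 2 → suc x ≤ i
    i-large {x} x≤2 = +-cancelʳ-≤ b (suc x) i (subst (suc x + b ≤_) (sym i+b≡)
                        (≤-trans (s≤s (+-mono-≤ x≤2 b≤2)) (≤-trans room (n≤1+n k))))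

    i≥1 : 1 ≤ i
    i≥1 = ≤-trans (s≤s z≤n) (i-large b≤2)

    whole-ring : suc (suc b + i) ≡ 3 + k
    whole-ring = cong (suc ∘ suc) (trans (+-comm b i) i+b≡)

    -- The walk first reaches K - b - 1 at time T3.  Its maximum K + c before T3
    -- lies beyond K + a + 1, and the trap is the arc [K - b - 1, K + c + 1].
    left-exit : ∀ T3 → T3 ≤ K → (∀ t → t < T3 → Inside w K (suc b) i t) → w T3 + suc b ≡ K → Trap w K k p q
    left-exit zero _ _ at-T3 = ⊥-elim (m+1+n≢m K (trans (cong (_+ suc b) (sym w0)) at-T3))
    left-exit (suc T3') T3≤K inside at-T3 =
      trap (suc b) (suc c) (a + a + c + c + c + b + b + b + b + 3) (s≤s z≤n) (s≤s z≤n) fits ratio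
           (end-then-cross (suc T3') T3≤K inside′ (inj₂ at-T3) cost)
      where
        not-yet : ¬ (suc T3' ≤ T2)
        not-yet T3≤T2 with m≤n⇒m<n∨m≡n T3≤T2
        ... | inj₁ T3<T2 = <-irrefl refl (begin-strict
          K                   ≡⟨ sym at-tb ⟩
          w tb + b            ≤⟨ +-monoˡ-≤ b (lowest (suc T3') T3<T2) ⟩
          w (suc T3') + b     <⟨ +-monoʳ-< (w (suc T3')) (n<1+n b) ⟩
          w (suc T3') + suc b ≡⟨ at-T3 ⟩
          K                   ∎)
          where open ≤-Reasoning
        ... | inj₂ refl = m+1+n≢m K (begin
          K + suc (a + suc b) ≡⟨ solve (K ∷ a ∷ b ∷ []) ⟩
          K + suc a + suc b   ≡⟨ cong (_+ suc b) (sym at-T2) ⟩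
          w T2 + suc b        ≡⟨ at-T3 ⟩
          K                   ∎)
          where open ≡-Reasoning

        T2≤T3' : T2 ≤ T3'
        T2≤T3' = ≮⇒≥ not-yet

        open Peak (peak T3' (suc a) T2 T2≤T3' (≤-reflexive (sym at-T2))) renaming (top to c; t-top to tc)

        c<i : c < i
        c<i = +-cancelˡ-≤ K (suc c) i (subst (_≤ K + i) (sym (+-suc K c))
                (subst (λ x → suc x ≤ K + i) w-top (proj₂ (inside tc (s≤s t-top≤T)))))

        T2≤tc : T2 ≤ tc
        T2≤tc = ≮⇒≥ λ tc<T2 → <-irrefl refl
          (<-≤-trans (below-T2 tc tc<T2) (subst (K + suc a ≤_) (sym w-top) (+-monoʳ-≤ K x≤top)))

        tc≤K : tc ≤ K
        tc≤K = ≤-trans (m≤n⇒m≤1+n t-top≤T) T3≤K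

        rise : c + tb + b ≤ tc
        rise = span-bound b at-tb w-top (rise-bound (≤-trans (<⇒≤ tb<T2) T2≤tc) tc≤K)

        fall : c + tc + suc b ≤ suc T3'
        fall = span-bound (suc b) at-T3 w-top (fall-bound (m≤n⇒m≤1+n t-top≤T) T3≤K)

        fits : suc (suc b + suc c) ≤ 3 + k
        fits = s≤s (s≤s (subst (_≤ suc k) (sym (+-suc b c))
                 (subst (suc (b + c) ≤_) i+b≡ (subst (_≤ i + b) (cong suc (+-comm c b)) (+-monoˡ-≤ b c<i)))))

        inside′ : ∀ t → t < suc T3' → Inside w K (suc b) (suc c) t
        inside′ t t<T3 = proj₁ (inside t t<T3) ,
                         ≤-trans (s≤s (below-top t (≤-pred t<T3))) (≤-reflexive (sym (+-suc K c)))

        cost : a + a + c + c + c + b + b + b + b + 3 ≤ suc T3' + (suc b + suc c)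
        cost = add-right (suc b + suc c) (regroup a b c)
                 (≤-trans (+-monoˡ-≤ (suc b) (+-monoʳ-≤ c (≤-trans (+-monoˡ-≤ b (+-monoʳ-≤ c tb-late)) rise))) fall)
          where regroup : ∀ a b c → c + (c + (a + a + b) + b) + suc b + (suc b + suc c) ≡ a + a + c + c + c + b + b + b + b + 3
                regroup = solve-∀

        -- the optimum is at most 2b + c + 3, and 2 (2b + c + 3) ≤ cost as c > a ≥ 1
        ratio : p * (suc b + suc c + suc b ⊓ suc c) ≤ q * (a + a + c + c + c + b + b + b + b + 3)
        ratio = ratio-two q at-most-two (≤-trans (+-mono-≤ opt≤ opt≤) double)
          where
            opt≤ : suc b + suc c + suc b ⊓ suc c ≤ suc b + suc c + suc b
            opt≤ = +-monoʳ-≤ (suc b + suc c) (m⊓n≤m (suc b) (suc c))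
            double : (suc b + suc c + suc b) + (suc b + suc c + suc b) ≤ a + a + c + c + c + b + b + b + b + 3
            double = cancel-common {C = 3}
              (+-monoʳ-≤ (4 * b + 2 * c + 6) (≤-trans (n≤1+n 3) (+-mono-≤ (+-mono-≤ a≥1 a≥1) (≤-trans (s≤s a≥1) x≤top))))
              (ring₁ b c) (ring₂ a b c)
              where
                ring₁ : ∀ b c → suc b + suc c + suc b + (suc b + suc c + suc b) + 3 ≡ 4 * b + 2 * c + 6 + 3
                ring₁ = solve-∀
                ring₂ : ∀ a b c → 4 * b + 2 * c + 6 + (a + a + c) ≡ a + a + c + c + c + b + b + b + b + 3 + 3
                ring₂ = solve-∀

    outcome : Trap w K k p q
    outcome with first-exit (suc b) i (s≤s z≤n) i≥1
    ... | never-exits inside = never-exiting (suc b) i (s≤s z≤n) i≥1 (≤-reflexive whole-ring) inside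
    ... | exits-left T3 T3≤K inside at-T3 = left-exit T3 T3≤K inside at-T3
    ... | exits-right T T≤K inside at-T =
          trap (suc b) i (k + k + b + 5) (s≤s z≤n) i≥1 (≤-reflexive whole-ring) ratio
               (end-then-cross T T≤K inside (inj₁ at-T) cost)
      where
        -- the optimum of this arc is (k + 2) + (b + 1)
        ratio : p * (suc b + i + suc b ⊓ i) ≤ q * (k + k + b + 5)
        ratio = subst (λ m → p * m ≤ q * (k + k + b + 5)) (sym opt≡) (third b b≥1 b≤2)
          where
            ring : ∀ b i → suc b + i + suc b ≡ i + b + 2 + b
            ring = solve-∀
            opt≡ : suc b + i + suc b ⊓ i ≡ k + 3 + b
            opt≡ = begin
              suc b + i + suc b ⊓ i ≡⟨ cong (suc b + i +_) (m≤n⇒m⊓n≡m (i-large b≤2)) ⟩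
              suc b + i + suc b     ≡⟨ ring b i ⟩
              i + b + 2 + b         ≡⟨ cong (λ x → x + 2 + b) i+b≡ ⟩
              suc k + 2 + b         ≡⟨ solve (k ∷ b ∷ []) ⟩
              k + 3 + b             ∎
              where open ≡-Reasoning

        tb≤T : tb ≤ T
        tb≤T = ≮⇒≥ λ T<tb → <-irrefl at-T
          (≤-trans (below-T2 T (<-trans T<tb tb<T2)) (+-monoʳ-≤ K (i-large a≤2)))

        rise : i + tb + b ≤ T
        rise = span-bound b at-tb at-T (rise-bound tb≤T T≤K)

        cost : k + k + b + 5 ≤ T + (suc b + i)
        cost = add-right (suc b + i) regroup
                 (≤-trans (+-monoˡ-≤ b (+-monoʳ-≤ i (≤-trans (+-monoˡ-≤ b (+-mono-≤ a≥1 a≥1)) tb-late))) rise)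
          where
            open ≡-Reasoning
            ring : ∀ i b → i + (1 + 1 + b) + b + (suc b + i) ≡ (i + b) + (i + b) + b + 3
            ring = solve-∀
            regroup : i + (1 + 1 + b) + b + (suc b + i) ≡ k + k + b + 5
            regroup = begin
              i + (1 + 1 + b) + b + (suc b + i) ≡⟨ ring i b ⟩
              (i + b) + (i + b) + b + 3         ≡⟨ cong (λ x → x + x + b + 3) i+b≡ ⟩
              suc k + suc k + b + 3             ≡⟨ solve (k ∷ b ∷ []) ⟩
              k + k + b + 5                     ∎

  -- Round two.  The walk went right to its maximum K + a (a ≤ 2) at time ta and
  -- first came back to K - 1 at time T1.  The adversary proposes the arc
  -- [K - j, K + a + 1] with j + a = k + 1.
  module Round₂ (a : ℕ) (a≥1 : 1 ≤ a) (a≤2 : a ≤ 2) (long : LongGame k p q a)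
                (T1 : ℕ) (T1≤K : T1 ≤ K) (at-T1 : w T1 + 1 ≡ K)
                (ta : ℕ) (ta<T1 : ta < T1) (at-ta : w ta ≡ K + a) (a≤ta : a ≤ ta)
                (above-T1 : ∀ t → t < T1 → K ≤ w t) (below-T1 : ∀ t → t < T1 → w t ≤ K + a) where

    open LongGame long

    j : ℕ
    j = suc k ∸ a

    j+a≡ : j + a ≡ suc k
    j+a≡ = m∸n+n≡m (≤-trans a≤2 (≤-trans (s≤s (s≤s z≤n)) (≤-trans room (n≤1+n k))))

    -- Since k ≥ 5 the left part j of the arc exceeds a.
    a<j : suc a ≤ j
    a<j = +-cancelʳ-≤ a (suc a) j (subst (suc a + a ≤_) (sym j+a≡)
            (≤-trans (s≤s (+-mono-≤ a≤2 a≤2)) (≤-trans room (n≤1+n k))))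

    j≥1 : 1 ≤ j
    j≥1 = ≤-trans (s≤s z≤n) a<j

    whole-ring : suc (j + suc a) ≡ 3 + k
    whole-ring = cong suc (trans (+-suc j a) (cong suc j+a≡))

    after-T1 : ∀ {t x} → 1 ≤ x → w t + x ≡ K → T1 ≤ t
    after-T1 {t} {x} x≥1 low = ≮⇒≥ λ t<T1 → <-irrefl refl (begin-strict
      K        <⟨ ≤-trans (≤-reflexive (+-comm 1 K)) (+-monoʳ-≤ K x≥1) ⟩
      K + x    ≤⟨ +-monoˡ-≤ x (above-T1 t t<T1) ⟩
      w t + x  ≡⟨ low ⟩
      K        ∎)
      where open ≤-Reasoning

    -- The walk first reaches K + a + 1 at time T2 = suc T2', after its minimum
    -- K - b on [0, T2) (attained after T1).  For b ≤ 2 round three starts;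
    -- otherwise the arc [K - b - 1, K + a + 1] is the trap.
    module RightExit (T2' : ℕ) (T2≤K : suc T2' ≤ K) (inside : ∀ t → t < suc T2' → Inside w K j (suc a) t)
                     (at-T2 : w (suc T2') ≡ K + suc a) where

      not-yet : ¬ (suc T2' ≤ T1)
      not-yet T2≤T1 with m≤n⇒m<n∨m≡n T2≤T1
      ... | inj₁ T2<T1 = <-irrefl at-T2 (≤-trans (s≤s (below-T1 (suc T2') T2<T1)) (≤-reflexive (sym (+-suc K a))))
      ... | inj₂ refl = m+1+n≢m K (begin
        K + suc (a + 1) ≡⟨ solve (K ∷ a ∷ []) ⟩
        K + suc a + 1   ≡⟨ cong (_+ 1) (sym at-T2) ⟩
        w T1 + 1        ≡⟨ at-T1 ⟩
        K               ∎)
        where open ≡-Reasoning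

      T1≤T2' : T1 ≤ T2'
      T1≤T2' = ≮⇒≥ not-yet

      open Trough (trough T2' 1 T1 T1≤T2' (≤-reflexive at-T1)) renaming (depth to b; t-bot to tb)

      tb≤K : tb ≤ K
      tb≤K = ≤-trans (m≤n⇒m≤1+n t-bot≤T) T2≤K

      fall : a + ta + b ≤ tb
      fall = span-bound b w-bot at-ta (fall-bound (≤-trans (<⇒≤ ta<T1) (after-T1 x≤depth w-bot)) tb≤K)

      tb-late : a + a + b ≤ tb
      tb-late = ≤-trans (+-monoˡ-≤ b (+-monoʳ-≤ a a≤ta)) fall

      rise : suc a + tb + b ≤ suc T2'
      rise = span-bound b w-bot at-T2 (rise-bound (m≤n⇒m≤1+n t-bot≤T) T2≤K)

      -- a deep trough (b ≥ 3) makes [K - b - 1, K + a + 1] a trap with ratio 2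
      deep : 3 ≤ b → Trap w K k p q
      deep b≥3 = trap (suc b) (suc a) (a + a + a + a + b + b + b + 3) (s≤s z≤n) (s≤s z≤n) fits ratio
                   (end-then-cross (suc T2') T2≤K inside′ (inj₁ at-T2) cost)
        where
          b<j : b < j
          b<j = +-cancelˡ-≤ (w tb) (suc b) j (subst (_≤ w tb + j) (sym (+-suc (w tb) b))
                  (subst (_< w tb + j) (sym w-bot) (proj₁ (inside tb (s≤s t-bot≤T)))))

          fits : suc (suc b + suc a) ≤ 3 + k
          fits = s≤s (s≤s (subst (_≤ suc k) (sym (+-suc b a)) (s≤s (≤-pred (subst (suc b + a ≤_) j+a≡ (+-monoˡ-≤ a b<j))))))

          inside′ : ∀ t → t < suc T2' → Inside w K (suc b) (suc a) t
          inside′ t t<T2 = ≤-trans (≤-reflexive (trans (cong suc (sym w-bot)) (sym (+-suc (w tb) b))))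
                                   (+-monoˡ-≤ (suc b) (above-bot t (≤-pred t<T2))) ,
                           proj₂ (inside t t<T2)

          cost : a + a + a + a + b + b + b + 3 ≤ suc T2' + (suc b + suc a)
          cost = add-right (suc b + suc a) (regroup a b) (≤-trans (+-monoˡ-≤ b (+-monoʳ-≤ (suc a) tb-late)) rise)
            where regroup : ∀ a b → suc a + (a + a + b) + b + (suc b + suc a) ≡ a + a + a + a + b + b + b + 3
                  regroup = solve-∀

          -- the optimum is at most b + 2a + 3, and twice that is at most the cost as b ≥ 3
          ratio : p * (suc b + suc a + suc b ⊓ suc a) ≤ q * (a + a + a + a + b + b + b + 3)
          ratio = ratio-two q at-most-two (≤-trans (+-mono-≤ opt≤ opt≤) double)
            where
              opt≤ : suc b + suc a + suc b ⊓ suc a ≤ suc b + suc a + suc a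
              opt≤ = +-monoʳ-≤ (suc b + suc a) (m⊓n≤n (suc b) (suc a))
              ring₁ : ∀ a b → suc b + suc a + suc a + (suc b + suc a + suc a) + 3 ≡ b + b + a + a + a + a + 6 + 3
              ring₁ = solve-∀
              ring₂ : ∀ a b → b + b + a + a + a + a + 6 + b ≡ a + a + a + a + b + b + b + 3 + 3
              ring₂ = solve-∀
              double : (suc b + suc a + suc a) + (suc b + suc a + suc a) ≤ a + a + a + a + b + b + b + 3
              double = cancel-common {C = 3} (+-monoʳ-≤ (b + b + a + a + a + a + 6) b≥3) (ring₁ a b) (ring₂ a b)

      outcome : Trap w K k p q
      outcome with b ≤? 2
      ... | yes b≤2 = Round₃.outcome a a≥1 a≤2 long b x≤depth b≤2 (suc T2') T2≤K at-T2
                        (λ t t<T2 → proj₂ (inside t t<T2)) tb (s≤s t-bot≤T) w-bot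
                        (λ t t<T2 → above-bot t (≤-pred t<T2)) tb-late
      ... | no b>2 = deep (≰⇒> b>2)

    outcome : Trap w K k p q
    outcome with first-exit j (suc a) j≥1 (s≤s z≤n)
    ... | never-exits inside = never-exiting j (suc a) j≥1 (s≤s z≤n) (≤-reflexive whole-ring) inside
    ... | exits-right zero _ _ at-T2 = ⊥-elim (m+1+n≢m K (trans (sym at-T2) w0))
    ... | exits-right (suc T2') T2≤K inside at-T2 = RightExit.outcome T2' T2≤K inside at-T2
    ... | exits-left T T≤K inside at-T =
          trap j (suc a) (k + k + a + 3) j≥1 (s≤s z≤n) (≤-reflexive whole-ring) ratio
               (end-then-cross T T≤K inside (inj₂ at-T) cost)
      where
        -- the optimum of this arc is (k + 2) + (a + 1)
        ratio : p * (j + suc a + j ⊓ suc a) ≤ q * (k + k + a + 3)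
        ratio = subst (λ m → p * m ≤ q * (k + k + a + 3)) (sym opt≡) second
          where
            ring : ∀ j a → j + suc a + suc a ≡ j + a + a + 2
            ring = solve-∀
            opt≡ : j + suc a + j ⊓ suc a ≡ k + 3 + a
            opt≡ = begin
              j + suc a + j ⊓ suc a ≡⟨ cong (j + suc a +_) (m≥n⇒m⊓n≡n a<j) ⟩
              j + suc a + suc a     ≡⟨ ring j a ⟩
              j + a + a + 2         ≡⟨ cong (λ x → x + a + 2) j+a≡ ⟩
              suc k + a + 2         ≡⟨ solve (k ∷ a ∷ []) ⟩
              k + 3 + a             ∎
              where open ≡-Reasoning

        fall : a + ta + j ≤ T
        fall = span-bound j at-T at-ta (fall-bound (≤-trans (<⇒≤ ta<T1) (after-T1 j≥1 at-T)) T≤K)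

        cost : k + k + a + 3 ≤ T + (j + suc a)
        cost = add-right (j + suc a) regroup (≤-trans (+-monoˡ-≤ j (+-monoʳ-≤ a a≤ta)) fall)
          where
            open ≡-Reasoning
            ring : ∀ j a → a + a + j + (j + suc a) ≡ (j + a) + (j + a) + a + 1
            ring = solve-∀
            regroup : a + a + j + (j + suc a) ≡ k + k + a + 3
            regroup = begin
              a + a + j + (j + suc a)   ≡⟨ ring j a ⟩
              (j + a) + (j + a) + a + 1 ≡⟨ cong (λ x → x + x + a + 1) j+a≡ ⟩
              suc k + suc k + a + 1     ≡⟨ solve (k ∷ a ∷ []) ⟩
              k + k + a + 3             ∎

  -- Round one ended on the left: the walk reached its maximum K + a at time ta
  -- and first came back to K - 1 at time T1.  The trap is [K - 1, K + a + 1]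
  -- unless a ≤ 2 and the rate asks for round two.
  module FirstTurn (T1' : ℕ) (T1≤K : suc (suc T1') ≤ K)
                   (inside : ∀ t → t < suc (suc T1') → Inside w K 1 (suc k) t)
                   (at-T1 : w (suc (suc T1')) + 1 ≡ K) where

    T1 : ℕ
    T1 = suc (suc T1')

    open Peak (peak (suc T1') 1 1 (s≤s z≤n) (≤-reflexive (trans (+-comm K 1) (sym w1)))) renaming (top to a; t-top to ta)

    ta≤K : ta ≤ K
    ta≤K = ≤-trans (m≤n⇒m≤1+n t-top≤T) T1≤K

    a≤ta : a ≤ ta
    a≤ta = +-cancelˡ-≤ K a ta (subst (_≤ K + ta) w-top (height≤time ta≤K))

    fall : a + ta + 1 ≤ T1
    fall = span-bound 1 at-T1 w-top (fall-bound (m≤n⇒m≤1+n t-top≤T) T1≤K)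

    trap-at : p * (1 + suc a + 1 ⊓ suc a) ≤ q * (a + a + a + 3) → Trap w K k p q
    trap-at ratio = trap 1 (suc a) (a + a + a + 3) (s≤s z≤n) (s≤s z≤n) fits ratio
                      (end-then-cross T1 T1≤K inside′ (inj₂ at-T1) cost)
      where
        a≤k : a ≤ k
        a≤k = ≤-pred (+-cancelˡ-≤ K (suc a) (suc k) (subst (_≤ K + suc k) (sym (+-suc K a))
                (subst (λ x → suc x ≤ K + suc k) w-top (proj₂ (inside ta (s≤s t-top≤T))))))

        fits : suc (1 + suc a) ≤ 3 + k
        fits = s≤s (s≤s (s≤s a≤k))

        inside′ : ∀ t → t < T1 → Inside w K 1 (suc a) t
        inside′ t t<T1 = proj₁ (inside t t<T1) ,
                         ≤-trans (s≤s (below-top t (≤-pred t<T1))) (≤-reflexive (sym (+-suc K a)))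

        cost : a + a + a + 3 ≤ T1 + (1 + suc a)
        cost = add-right (1 + suc a) (regroup a) (≤-trans (+-monoˡ-≤ 1 (+-monoʳ-≤ a a≤ta)) fall)
          where regroup : ∀ a → a + a + 1 + (1 + suc a) ≡ a + a + a + 3
                regroup = solve-∀

    -- a long excursion (a ≥ 3) already costs twice the optimum a + 3
    long-excursion : 3 ≤ a → p * (1 + suc a + 1 ⊓ suc a) ≤ q * (a + a + a + 3)
    long-excursion a≥3 = ratio-two q at-most-two (cancel-common {C = 3} (+-monoʳ-≤ (a + a + 6) a≥3) (ring₁ a) (ring₂ a))
      where
        ring₁ : ∀ a → suc (suc a) + 1 + (suc (suc a) + 1) + 3 ≡ a + a + 6 + 3
        ring₁ = solve-∀
        ring₂ : ∀ a → a + a + 6 + a ≡ a + a + a + 3 + 3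
        ring₂ = solve-∀

    outcome : Trap w K k p q
    outcome with a ≤? 2
    ... | no a>2 = trap-at (long-excursion (≰⇒> a>2))
    ... | yes a≤2 with short-turn a x≤top a≤2
    ...   | inj₁ ratio = trap-at (subst (λ m → p * m ≤ q * (a + a + a + 3)) (opt≡ a) ratio)
      where opt≡ : ∀ a → a + 3 ≡ suc (suc a) + 1
            opt≡ = solve-∀
    ...   | inj₂ long = Round₂.outcome a x≤top a≤2 long T1 T1≤K at-T1 ta (s≤s t-top≤T) w-top a≤ta
                          (λ t t<T1 → ≤-pred (subst (suc K ≤_) (+-comm (w t) 1) (proj₁ (inside t t<T1))))
                          (λ t t<T1 → below-top t (≤-pred t<T1))

  -- Round one: the arc [K - 1, K + k + 1].
  adversary : Trap w K k p q
  adversary with first-exit 1 (suc k) (s≤s z≤n) (s≤s z≤n)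
  ... | never-exits inside = never-exiting 1 (suc k) (s≤s z≤n) (s≤s z≤n) ≤-refl inside
  ... | exits-left zero _ _ at-T1 = ⊥-elim (m+1+n≢m K (trans (cong (_+ 1) (sym w0)) at-T1))
  ... | exits-left (suc zero) _ _ at-T1 = ⊥-elim (m+1+n≢m K {1} (trans (+-suc K 1) (trans (cong (_+ 1) (sym w1)) at-T1)))
  ... | exits-left (suc (suc T1')) T1≤K inside at-T1 = FirstTurn.outcome T1' T1≤K inside at-T1
  ... | exits-right T T≤K inside at-T =
        trap 1 (suc k) (k + k + 3) (s≤s z≤n) (s≤s z≤n) ≤-refl ratio (end-then-cross T T≤K inside (inj₁ at-T) cost)
    where
      opt≡ : ∀ k → k + 3 ≡ 1 + suc k + 1
      opt≡ = solve-∀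

      ratio : p * (1 + suc k + 1 ⊓ suc k) ≤ q * (k + k + 3)
      ratio = subst (λ m → p * m ≤ q * (k + k + 3)) (opt≡ k) first-round

      k<T : suc k ≤ T
      k<T = +-cancelˡ-≤ K (suc k) T (subst (_≤ K + T) at-T (height≤time T≤K))

      cost : k + k + 3 ≤ T + (1 + suc k)
      cost = add-right (2 + k) (regroup k) k<T
        where regroup : ∀ k → suc k + (2 + k) ≡ k + k + 3
              regroup = solve-∀

-- Reflecting a walk about K swaps the left and right parts of every arc, so a
-- trap for the reflected walk is a trap for the walk itself.
module Mirror (w w′ : ℕ → ℕ) (K : ℕ) (reflect : ∀ t → t ≤ K → w t + w′ t ≡ K + K) where

  inside-mirror : ∀ {L R t} → t ≤ K → Inside w′ K L R t → Inside w K R L t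
  inside-mirror {L} {R} {t} t≤K (left , right) =
    cancel-common {C = K} (+-monoʳ-≤ (w t) right) left-sum (regroup₁ (w t) K R) ,
    cancel-common {C = K} (+-monoʳ-≤ (w t) left) (regroup₂ (w t) K) right-sum
    where
      regroup₁ : ∀ x K R → x + (K + R) ≡ x + R + K
      regroup₁ = solve-∀
      regroup₂ : ∀ x K → suc x + K ≡ x + suc K
      regroup₂ = solve-∀
      left-sum : suc K + K ≡ w t + suc (w′ t)
      left-sum = trans (cong suc (sym (reflect t t≤K))) (sym (+-suc (w t) (w′ t)))
      right-sum : w t + (w′ t + L) ≡ K + L + K
      right-sum = trans (sym (+-assoc (w t) (w′ t) L)) (trans (cong (_+ L) (reflect t t≤K)) (regroup₃ K L))
        where regroup₃ : ∀ K L → K + K + L ≡ K + L + K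
              regroup₃ = solve-∀

  at-end-mirror : ∀ {L R T} → T ≤ K → AtEnd w′ K L R T → AtEnd w K R L T
  at-end-mirror {L} {R} {T} T≤K (inj₁ at-right) = inj₂ (+-cancelʳ-≡ K (w T + R) K (begin
    w T + R + K       ≡⟨ regroup (w T) R K ⟩
    w T + (K + R)     ≡⟨ cong (w T +_) (sym at-right) ⟩
    w T + w′ T        ≡⟨ reflect T T≤K ⟩
    K + K             ∎))
    where
      open ≡-Reasoning
      regroup : ∀ x R K → x + R + K ≡ x + (K + R)
      regroup = solve-∀
  at-end-mirror {L} {R} {T} T≤K (inj₂ at-left) = inj₁ (+-cancelʳ-≡ (w′ T) (w T) (K + L) (begin
    w T + w′ T            ≡⟨ reflect T T≤K ⟩
    K + K                 ≡⟨ cong (λ x → x + x) (sym at-left) ⟩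
    w′ T + L + (w′ T + L) ≡⟨ regroup (w′ T) L ⟩
    w′ T + L + L + w′ T   ≡⟨ cong (λ x → x + L + w′ T) at-left ⟩
    K + L + w′ T          ∎))
    where
      open ≡-Reasoning
      regroup : ∀ x L → x + L + (x + L) ≡ x + L + L + x
      regroup = solve-∀

  trap-mirror : ∀ {k p q} → Trap w′ K k p q → Trap w K k p q
  trap-mirror {k} {p} {q} (trap L R B L≥1 R≥1 fits ratio forced) =
    trap R L B R≥1 L≥1 (subst (λ m → suc m ≤ 3 + k) (+-comm L R) fits)
      (subst (λ m → p * m ≤ q * B) (cong₂ _+_ (+-comm L R) (⊓-comm L R)) ratio) (forced-mirror forced)
    where
      forced-mirror : ForcedCost w′ K L R B → ForcedCost w K R L B
      forced-mirror (end-then-cross T T≤K inside at-end B≤) =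
        end-then-cross T T≤K (λ t t<T → inside-mirror (≤-trans (<⇒≤ t<T) T≤K) (inside t t<T))
          (at-end-mirror T≤K at-end) (subst (λ m → B ≤ T + m) (+-comm L R) B≤)
      forced-mirror (stays-inside B≤K inside) =
        stays-inside B≤K (λ t t<B → inside-mirror (≤-trans (<⇒≤ t<B) B≤K) (inside t t<B))

module _ {n : ℕ} .{{_ : NonZero n}} where

  endpoint : Fin n → List Dir → Fin n
  endpoint u []       = u
  endpoint u (d ∷ ds) = endpoint (move u d) ds

  endpoint-snoc : ∀ u xs d → endpoint u (xs ++ [ d ]) ≡ move (endpoint u xs) d
  endpoint-snoc u []       d = refl
  endpoint-snoc u (x ∷ xs) d = endpoint-snoc (move u x) xs d

  visited-++ʳ : ∀ u xs ys {x} → x ∈ visited (endpoint u xs) ys → x ∈ visited u (xs ++ ys)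
  visited-++ʳ u []       ys m = m
  visited-++ʳ u (d ∷ xs) ys m = there (visited-++ʳ (move u d) xs ys m)

  visited-snoc : ∀ u xs d {x} → x ∈ visited u (xs ++ [ d ]) → x ∈ visited u xs ⊎ x ≡ move (endpoint u xs) d
  visited-snoc u []       d (here refl)         = inj₁ (here refl)
  visited-snoc u []       d (there (here refl)) = inj₂ refl
  visited-snoc u (x ∷ xs) d (here refl)         = inj₁ (here refl)
  visited-snoc u (x ∷ xs) d (there m)           = Data.Sum.map₁ there (visited-snoc (move u x) xs d m)

  valid-++ : ∀ {F u xs ys} → ValidWalk F u xs → ValidWalk F (endpoint u xs) ys → ValidWalk F u (xs ++ ys)
  valid-++ []       v₂ = v₂
  valid-++ (e ∷ v₁) v₂ = e ∷ valid-++ v₁ v₂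

  valid-split : ∀ {F u} xs ys → ValidWalk F u (xs ++ ys) → ValidWalk F u xs × ValidWalk F (endpoint u xs) ys
  valid-split []       ys v       = [] , v
  valid-split (x ∷ xs) ys (e ∷ v) = Data.Product.map₁ (e ∷_) (valid-split xs ys v)

  step : Algorithm → FaultConf n → State → State
  step A F s = st p′ (obs F p′ ∷ hist s) (A (hist s) ∷ moves s)
    where p′ = move (pos s) (A (hist s))

  module _ (A : Algorithm) (F : FaultConf n) (v : Fin n) where

    move-at : ℕ → Dir
    move-at t = A (hist (run A F v t))

    run-suc : ∀ k → run A F v (suc k) ≡ step A F (run A F v k)
    run-suc k with run A F v k
    ... | st p h ms = refl

    pos-suc : ∀ k → pos (run A F v (suc k)) ≡ move (pos (run A F v k)) (move-at k)
    pos-suc k = cong pos (run-suc k)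

    runMoves-suc : ∀ k → runMoves A F v (suc k) ≡ runMoves A F v k ++ [ move-at k ]
    runMoves-suc k rewrite run-suc k = unfold-reverse (move-at k) (moves (run A F v k))

    endpoint-run : ∀ k → endpoint v (runMoves A F v k) ≡ pos (run A F v k)
    endpoint-run zero    = refl
    endpoint-run (suc k) = begin
      endpoint v (runMoves A F v (suc k))          ≡⟨ cong (endpoint v) (runMoves-suc k) ⟩
      endpoint v (runMoves A F v k ++ [ move-at k ]) ≡⟨ endpoint-snoc v (runMoves A F v k) (move-at k) ⟩
      move (endpoint v (runMoves A F v k)) (move-at k) ≡⟨ cong (λ u → move u (move-at k)) (endpoint-run k) ⟩
      move (pos (run A F v k)) (move-at k)         ≡⟨ sym (pos-suc k) ⟩
      pos (run A F v (suc k))                      ∎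
      where open ≡-Reasoning

    healthy-moves : ∀ k → ValidWalk F v (runMoves A F v k) → ∀ t → t < k →
                    F (edgeOf (pos (run A F v t)) (move-at t)) ≡ false
    healthy-moves (suc k) valid t t<1+k
      with valid-split (runMoves A F v k) _ (subst (ValidWalk F v) (runMoves-suc k) valid)
    ... | valid-k , (e ∷ []) with m≤n⇒m<n∨m≡n (≤-pred t<1+k)
    ...   | inj₁ t<k  = healthy-moves k valid-k t t<k
    ...   | inj₂ refl = subst (λ u → F (edgeOf u (move-at t)) ≡ false) (endpoint-run t) e

    visit-time : ∀ k {x} → x ∈ visited v (runMoves A F v k) → Σ ℕ λ t → t ≤ k × pos (run A F v t) ≡ x
    visit-time zero    (here refl) = 0 , z≤n , refl
    visit-time (suc k) m
      with visited-snoc v (runMoves A F v k) (move-at k) (subst (λ ds → _ ∈ visited v ds) (runMoves-suc k) m)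
    ... | inj₁ m′ = Data.Product.map₂ (Data.Product.map₁ m≤n⇒m≤1+n) (visit-time k m′)
    ... | inj₂ refl = suc k , ≤-refl , trans (pos-suc k) (cong (λ u → move u (move-at k)) (sym (endpoint-run k)))

  module _ (A : Algorithm) (F F′ : FaultConf n) (v : Fin n) where

    Indistinguishable : ℕ → Set
    Indistinguishable T = ∀ t → t < T → obs F (pos (run A F′ v t)) ≡ obs F′ (pos (run A F′ v t))

    same-run : ∀ T → Indistinguishable T → ∀ t → t < T → run A F v t ≡ run A F′ v t
    same-run T same zero    0<T   = cong (λ o → st v (o ∷ []) []) (same 0 0<T)
    same-run T same (suc t) 1+t<T = begin
      run A F v (suc t)         ≡⟨ run-suc A F v t ⟩
      step A F (run A F v t)    ≡⟨ cong (step A F) (same-run T same t (<-trans (n<1+n t) 1+t<T)) ⟩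
      step A F (run A F′ v t)   ≡⟨ cong (λ o → st (pos s′) (o ∷ hist s) (A (hist s) ∷ moves s)) same-obs ⟩
      step A F′ (run A F′ v t)  ≡⟨ sym (run-suc A F′ v t) ⟩
      run A F′ v (suc t)        ∎
      where
        open ≡-Reasoning
        s s′ : State
        s = run A F′ v t
        s′ = step A F′ s
        same-obs : obs F (pos s′) ≡ obs F′ (pos s′)
        same-obs = subst (λ u → obs F u ≡ obs F′ u) (pos-suc A F′ v t) (same (suc t) 1+t<T)

    -- the position at time T only depends on the moves before T
    same-pos : ∀ T → Indistinguishable T → pos (run A F v T) ≡ pos (run A F′ v T)
    same-pos zero    _    = refl
    same-pos (suc t) same = begin
      pos (run A F v (suc t))                      ≡⟨ pos-suc A F v t ⟩
      move (pos (run A F v t)) (move-at A F v t)   ≡⟨ cong (λ s → move (pos s) (A (hist s))) (same-run (suc t) same t ≤-refl) ⟩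
      move (pos (run A F′ v t)) (move-at A F′ v t) ≡⟨ sym (pos-suc A F′ v t) ⟩
      pos (run A F′ v (suc t))                     ∎
      where open ≡-Reasoning

-- A ring of size N = suc n1 read through the coordinate phi u = (u + c) mod N.
-- A clockwise move adds one to phi except at phi = n1, a counterclockwise
-- move subtracts one except at phi = 0.
module Coordinate (n1 c : ℕ) where

  N : ℕ
  N = suc n1

  %-absorbˡ : ∀ x y → (x % N + y) % N ≡ (x + y) % N
  %-absorbˡ x y = begin
    (x % N + y) % N           ≡⟨ %-distribˡ-+ (x % N) y N ⟩
    (x % N % N + y % N) % N   ≡⟨ cong (λ z → (z + y % N) % N) (m%n%n≡m%n x N) ⟩
    (x % N + y % N) % N       ≡⟨ sym (%-distribˡ-+ x y N) ⟩
    (x + y) % N               ∎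
    where open ≡-Reasoning

  phi : Fin N → ℕ
  phi u = (toℕ u + c) % N

  phi<N : ∀ u → phi u < N
  phi<N u = m%n<n (toℕ u + c) N

  phi-succR : ∀ u → phi (succR u) ≡ (phi u + 1) % N
  phi-succR u = begin
    (toℕ (succR u) + c) % N    ≡⟨ cong (λ z → (z + c) % N) (toℕ-fromℕ< (m%n<n (suc (toℕ u)) N)) ⟩
    (suc (toℕ u) % N + c) % N  ≡⟨ %-absorbˡ (suc (toℕ u)) c ⟩
    (suc (toℕ u) + c) % N      ≡⟨ cong (_% N) (+-comm 1 (toℕ u + c)) ⟩
    (toℕ u + c + 1) % N        ≡⟨ sym (%-absorbˡ (toℕ u + c) 1) ⟩
    (phi u + 1) % N            ∎
    where open ≡-Reasoning

  phi-predR : ∀ u → phi (predR u) ≡ (phi u + n1) % N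
  phi-predR u = begin
    (toℕ (predR u) + c) % N       ≡⟨ cong (λ z → (z + c) % N) (toℕ-fromℕ< (m%n<n (toℕ u + n1) N)) ⟩
    ((toℕ u + n1) % N + c) % N    ≡⟨ %-absorbˡ (toℕ u + n1) c ⟩
    (toℕ u + n1 + c) % N          ≡⟨ cong (_% N) (regroup (toℕ u) n1 c) ⟩
    (toℕ u + c + n1) % N          ≡⟨ sym (%-absorbˡ (toℕ u + c) n1) ⟩
    (phi u + n1) % N              ∎
    where
      open ≡-Reasoning
      regroup : ∀ x y z → x + y + z ≡ x + z + y
      regroup = solve-∀

  phi-cw : ∀ u → phi u ≢ n1 → phi (succR u) ≡ suc (phi u)
  phi-cw u phi≢n1 = trans (phi-succR u) (trans (cong (_% N) (+-comm (phi u) 1))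
                      (m<n⇒m%n≡m (s≤s (≤∧≢⇒< (≤-pred (phi<N u)) phi≢n1))))

  phi-ccw : ∀ u x → phi u ≡ suc x → phi (predR u) ≡ x
  phi-ccw u x phi≡ = begin
    phi (predR u)      ≡⟨ phi-predR u ⟩
    (phi u + n1) % N   ≡⟨ cong (λ z → (z + n1) % N) phi≡ ⟩
    (suc x + n1) % N   ≡⟨ cong (_% N) (+-suc x n1) ⟨
    (x + N) % N        ≡⟨ [m+n]%n≡m%n x N ⟩
    x % N              ≡⟨ m<n⇒m%n≡m (<-trans (n<1+n x) (subst (_< N) phi≡ (phi<N u))) ⟩
    x                  ∎
    where open ≡-Reasoning

  phi-ccw-zero : ∀ u → phi u ≡ 0 → phi (predR u) ≡ n1
  phi-ccw-zero u phi≡0 = trans (phi-predR u) (trans (cong (λ z → (z + n1) % N) phi≡0) (m<n⇒m%n≡m ≤-refl))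

  -- phi is a rotation, hence injective: adding d = N - c mod N undoes it.
  phi-injective : ∀ u u' → phi u ≡ phi u' → u ≡ u'
  phi-injective u u' phi≡ = toℕ-injective (trans (sym (undo u)) (trans (cong (λ z → (z + d) % N) phi≡) (undo u')))
    where
      d : ℕ
      d = N ∸ c % N
      regroup : ∀ x r s d → x + (r + s * N) + d ≡ x + (r + d) + s * N
      regroup = solve-∀
      undo : ∀ u → (phi u + d) % N ≡ toℕ u
      undo u = begin
        ((toℕ u + c) % N + d) % N                 ≡⟨ %-absorbˡ (toℕ u + c) d ⟩
        (toℕ u + c + d) % N                       ≡⟨ cong (λ z → (toℕ u + z + d) % N) (m≡m%n+[m/n]*n c N) ⟩
        (toℕ u + (c % N + (c / N) * N) + d) % N   ≡⟨ cong (_% N) (regroup (toℕ u) (c % N) (c / N) d) ⟩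
        (toℕ u + (c % N + d) + (c / N) * N) % N   ≡⟨ cong (λ z → (toℕ u + z + (c / N) * N) % N) (m+[n∸m]≡n (m%n≤n c N)) ⟩
        (toℕ u + N + (c / N) * N) % N             ≡⟨ [m+kn]%n≡m%n (toℕ u + N) (c / N) N ⟩
        (toℕ u + N) % N                           ≡⟨ [m+n]%n≡m%n (toℕ u) N ⟩
        toℕ u % N                                 ≡⟨ m<n⇒m%n≡m (toℕ<n u) ⟩
        toℕ u                                     ∎
        where open ≡-Reasoning

  -- The fault configuration with the two edges leaving phi = M and phi = n1
  -- clockwise cut (a single edge when M = n1): the nodes with phi ≤ M form a
  -- path, the arc.
  module ArcFaults (M : ℕ) (M≤n1 : M ≤ n1) where

    faulty : ℕ → Bool
    faulty x = does (x ≟ M) ∨ does (x ≟ n1)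

    F : FaultConf N
    F e = faulty (phi e)

    healthy : ∀ {x} → x ≢ M → x ≢ n1 → faulty x ≡ false
    healthy {x} x≢M x≢n1 rewrite dec-false (x ≟ M) x≢M | dec-false (x ≟ n1) x≢n1 = refl

    healthy⁻ : ∀ {x} → faulty x ≡ false → x ≢ M × x ≢ n1
    healthy⁻ {x} h = unequal (∨-conicalˡ _ _ h) , unequal (∨-conicalʳ _ _ h)
      where
        unequal : ∀ {y} → does (x ≟ y) ≡ false → x ≢ y
        unequal {y} is-false x≡y = contradiction (trans (sym (dec-true (x ≟ y) x≡y)) is-false) λ ()

    healthy-below : ∀ {x} → x < M → faulty x ≡ false
    healthy-below x<M = healthy (<⇒≢ x<M) (<⇒≢ (<-≤-trans x<M M≤n1))

    cw-healthy : ∀ u → F u ≡ false → phi (succR u) ≡ suc (phi u) × phi u ≢ M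
    cw-healthy u h = phi-cw u (proj₂ (healthy⁻ h)) , proj₁ (healthy⁻ h)

    ccw-healthy : ∀ u → F (predR u) ≡ false → Σ ℕ λ x → phi u ≡ suc x × phi (predR u) ≡ x
    ccw-healthy u h with phi u in phi≡
    ... | zero  = ⊥-elim (proj₂ (healthy⁻ h) (phi-ccw-zero u phi≡))
    ... | suc x = x , refl , phi-ccw u x phi≡

    move-bounds : ∀ u d → F (edgeOf u d) ≡ false → phi (move u d) ≤ suc (phi u) × phi u ≤ suc (phi (move u d))
    move-bounds u cw h rewrite proj₁ (cw-healthy u h) = ≤-refl , ≤-trans (n≤1+n _) (n≤1+n _)
    move-bounds u ccw h with ccw-healthy u h
    ... | x , e₁ , e₂ rewrite e₁ | e₂ = ≤-trans (n≤1+n _) (n≤1+n _) , ≤-refl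

    move-in-arc : ∀ u d → F (edgeOf u d) ≡ false → phi u ≤ M → phi (move u d) ≤ M
    move-in-arc u cw  h phi≤M rewrite proj₁ (cw-healthy u h) = ≤∧≢⇒< phi≤M (proj₂ (cw-healthy u h))
    move-in-arc u ccw h phi≤M with ccw-healthy u h
    ... | x , e₁ , e₂ rewrite e₂ = ≤-trans (n≤1+n x) (subst (_≤ M) e₁ phi≤M)

    interior-looks-healthy : ∀ u → 0 < phi u → phi u < M → obs F u ≡ (false , false)
    interior-looks-healthy u 0<phi phi<M = cong₂ _,_ (healthy-below phi<M) ccw-edge
      where
        ccw-edge : F (predR u) ≡ false
        ccw-edge with phi u in phi≡
        ... | suc x rewrite phi-ccw u x phi≡ = healthy-below (<-trans (n<1+n x) phi<M)

    component-in-arc : ∀ {u ds} → ValidWalk F u ds → phi u ≤ M → ∀ {x} → x ∈ visited u ds → phi x ≤ M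
    component-in-arc []          phi≤M (here refl) = phi≤M
    component-in-arc (_ ∷ _)     phi≤M (here refl) = phi≤M
    component-in-arc {u} {d ∷ _} (h ∷ valid) phi≤M (there m) = component-in-arc valid (move-in-arc u d h phi≤M) m

    spread : ∀ {u ds} → ValidWalk F u ds → ∀ {x} → x ∈ visited u ds → phi x ≤ phi u + length ds × phi u ≤ phi x + length ds
    spread [] (here refl) = ≤-reflexive (sym (+-identityʳ _)) , ≤-reflexive (sym (+-identityʳ _))
    spread (_ ∷ _) (here refl) = m≤m+n _ _ , m≤m+n _ _
    spread {u} {d ∷ ds} (h ∷ valid) (there m) with spread valid m | move-bounds u d h
    ... | (far₁ , far₂) | (step₁ , step₂) =
      ≤-trans far₁ (≤-trans (+-monoˡ-≤ (length ds) step₁) (≤-reflexive (sym (+-suc _ (length ds))))) ,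
      ≤-trans step₂ (≤-trans (s≤s far₂) (≤-reflexive (sym (+-suc _ (length ds)))))

    -- A valid walk from phi u ≤ M visiting both ends of the arc first goes to
    -- one end and then crosses the whole arc: it has length at least M + phi u
    -- or M + (M - phi u).
    both-ends-cost : 1 ≤ M → ∀ {u ds} → ValidWalk F u ds → phi u ≤ M → ∀ {x₀ x₁} →
      x₀ ∈ visited u ds → phi x₀ ≡ 0 → x₁ ∈ visited u ds → phi x₁ ≡ M →
      M + phi u ≤ length ds ⊎ M + (M ∸ phi u) ≤ length ds
    both-ends-cost M≥1 [] _ (here refl) at-0 (here refl) at-M = ⊥-elim (<⇒≢ M≥1 (sym (trans (sym at-M) at-0)))
    both-ends-cost M≥1 {u} {d ∷ ds} valid@(_ ∷ _) _ (here refl) at-0 m₁ at-M with spread valid m₁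
    ... | far , _ rewrite at-0 | at-M = inj₁ (subst (_≤ suc (length ds)) (sym (+-identityʳ M)) far)
    both-ends-cost M≥1 {u} {d ∷ ds} valid@(_ ∷ _) _ m₀@(there _) at-0 (here refl) at-M with spread valid m₀
    ... | _ , far rewrite at-0 | at-M | n∸n≡0 M = inj₂ (subst (_≤ suc (length ds)) (sym (+-identityʳ M)) far)
    both-ends-cost M≥1 {u} {d ∷ ds} (h ∷ valid) phi≤M (there m₀) at-0 (there m₁) at-M
      with both-ends-cost M≥1 valid (move-in-arc u d h phi≤M) m₀ at-0 m₁ at-M | move-bounds u d h
    ... | inj₁ rest | (_ , step₂) = inj₁ (≤-trans (+-monoʳ-≤ M step₂) (≤-trans (≤-reflexive (+-suc M _)) (s≤s rest)))
    ... | inj₂ rest | (step₁ , _) =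
          inj₂ (≤-trans (+-monoʳ-≤ M (∸-step M _ _ step₁)) (≤-trans (≤-reflexive (+-suc M _)) (s≤s rest)))

    Sweeps : Fin N → List Dir → ℕ → ℕ → Set
    Sweeps u ds lo hi = ∀ y → lo ≤ y → y ≤ hi → Σ (Fin N) λ x → x ∈ visited u ds × phi x ≡ y

    CwSweep : ℕ → Fin N → Set
    CwSweep i u = ValidWalk F u (replicate i cw) × phi (endpoint u (replicate i cw)) ≡ phi u + i ×
                  Sweeps u (replicate i cw) (phi u) (phi u + i)

    CcwSweep : ℕ → Fin N → Set
    CcwSweep i u = ValidWalk F u (replicate i ccw) × phi (endpoint u (replicate i ccw)) + i ≡ phi u ×
                   Sweeps u (replicate i ccw) (phi u ∸ i) (phi u)

    cw-sweep : ∀ i u → phi u + i ≤ M → CwSweep i u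
    cw-sweep zero u _ = [] , sym (+-identityʳ _) ,
      λ y lo≤y y≤hi → u , here refl , sym (≤-antisym (subst (y ≤_) (+-identityʳ _) y≤hi) lo≤y)
    cw-sweep (suc i) u fits = h ∷ valid , trans at-end (trans (cong (_+ i) phi-next) (sym (+-suc _ i))) , sweeps
      where
        phi<M : phi u < M
        phi<M = ≤-trans (s≤s (m≤m+n (phi u) i)) (≤-trans (≤-reflexive (sym (+-suc (phi u) i))) fits)
        h : F (edgeOf u cw) ≡ false
        h = healthy-below phi<M
        phi-next : phi (succR u) ≡ suc (phi u)
        phi-next = proj₁ (cw-healthy u h)
        shift : phi u + suc i ≡ phi (succR u) + i
        shift = trans (+-suc (phi u) i) (cong (_+ i) (sym phi-next))
        rest : CwSweep i (succR u)
        rest = cw-sweep i (succR u) (subst (_≤ M) shift fits)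
        valid : ValidWalk F (succR u) (replicate i cw)
        valid = proj₁ rest
        at-end : phi (endpoint (succR u) (replicate i cw)) ≡ phi (succR u) + i
        at-end = proj₁ (proj₂ rest)
        sweeps : Sweeps u (replicate (suc i) cw) (phi u) (phi u + suc i)
        sweeps y lo≤y y≤hi with m≤n⇒m<n∨m≡n lo≤y
        ... | inj₂ refl = u , here refl , refl
        ... | inj₁ lo<y with proj₂ (proj₂ rest) y (subst (_≤ y) (sym phi-next) lo<y) (subst (y ≤_) shift y≤hi)
        ...   | x , m , phi≡ = x , there m , phi≡

    ccw-sweep : ∀ i u → i ≤ phi u → phi u ≤ M → CcwSweep i u
    ccw-sweep zero u _ _ = [] , +-identityʳ _ ,
      λ y lo≤y y≤hi → u , here refl , ≤-antisym lo≤y y≤hi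
    ccw-sweep (suc i) u i<phi phi≤M with phi u in phi≡
    ... | suc x = h ∷ valid , trans (+-suc _ i) (cong suc (trans at-end phi-next)) , sweeps
      where
        h : F (edgeOf u ccw) ≡ false
        h rewrite phi-ccw u x phi≡ = healthy-below phi≤M
        phi-next : phi (predR u) ≡ x
        phi-next = phi-ccw u x phi≡
        rest : CcwSweep i (predR u)
        rest = ccw-sweep i (predR u) (subst (i ≤_) (sym phi-next) (≤-pred i<phi)) (subst (_≤ M) (sym phi-next) (<⇒≤ phi≤M))
        valid : ValidWalk F (predR u) (replicate i ccw)
        valid = proj₁ rest
        at-end : phi (endpoint (predR u) (replicate i ccw)) + i ≡ phi (predR u)
        at-end = proj₁ (proj₂ rest)
        sweeps : Sweeps u (replicate (suc i) ccw) (x ∸ i) (suc x)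
        sweeps y lo≤y y≤hi with m≤n⇒m<n∨m≡n y≤hi
        ... | inj₂ refl = u , here refl , phi≡
        ... | inj₁ y<hi with proj₂ (proj₂ rest) y (subst (λ z → z ∸ i ≤ y) (sym phi-next) lo≤y) (subst (y ≤_) (sym phi-next) (≤-pred y<hi))
        ...   | x′ , m , phi≡′ = x′ , there m , phi≡′

    -- Exploring the arc from a node u at coordinate L, with R = M - L, costs
    -- exactly M + min(L, R): walk to the nearer end, then sweep the whole arc.
    module Optimum (u : Fin N) (L R : ℕ) (phi-u : phi u ≡ L) (L+R≡M : L + R ≡ M) (M≥1 : 1 ≤ M) where

      phi-u≤M : phi u ≤ M
      phi-u≤M = subst₂ _≤_ (sym phi-u) L+R≡M (m≤m+n L R)

      M≡phi-u+R : phi u + R ≡ M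
      M≡phi-u+R = trans (cong (_+ R) phi-u) L+R≡M

      to-right : CwSweep R u
      to-right = cw-sweep R u (≤-reflexive M≡phi-u+R)

      to-left : CcwSweep L u
      to-left = ccw-sweep L u (≤-reflexive (sym phi-u)) phi-u≤M

      right-end : Σ (Fin N) λ x → x ∈ visited u (replicate R cw) × phi x ≡ M
      right-end = proj₂ (proj₂ to-right) M phi-u≤M (≤-reflexive (sym M≡phi-u+R))

      left-end : Σ (Fin N) λ x → x ∈ visited u (replicate L ccw) × phi x ≡ 0
      left-end = proj₂ (proj₂ to-left) 0 (≤-reflexive (trans (cong (_∸ L) phi-u) (n∸n≡0 L))) z≤n

      right-in-C : InC F u (proj₁ right-end)
      right-in-C = replicate R cw , proj₁ to-right , proj₁ (proj₂ right-end)

      left-in-C : InC F u (proj₁ left-end)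
      left-in-C = replicate L ccw , proj₁ to-left , proj₁ (proj₂ left-end)

      -- a covering walk visits both ends
      lower : ∀ ds → Covers F u ds → M + L ⊓ R ≤ length ds
      lower ds (valid , covers)
        with both-ends-cost M≥1 valid phi-u≤M (covers _ left-in-C) (proj₂ (proj₂ left-end))
                                              (covers _ right-in-C) (proj₂ (proj₂ right-end))
      ... | inj₁ h = ≤-trans (+-monoʳ-≤ M (m⊓n≤m L R)) (subst (λ z → M + z ≤ length ds) phi-u h)
      ... | inj₂ h = ≤-trans (+-monoʳ-≤ M (m⊓n≤n L R)) (subst (λ z → M + z ≤ length ds) M∸phi-u≡R h)
        where M∸phi-u≡R : M ∸ phi u ≡ R
              M∸phi-u≡R = trans (cong (_∸ phi u) (sym M≡phi-u+R)) (m+n∸m≡n (phi u) R)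

      cover-by : ∀ xs ys → ValidWalk F u xs → ValidWalk F (endpoint u xs) ys → Sweeps (endpoint u xs) ys 0 M →
                 Covers F u (xs ++ ys)
      cover-by xs ys valid₁ valid₂ sweeps = valid-++ valid₁ valid₂ , covered
        where
          covered : ∀ x → InC F u x → x ∈ visited u (xs ++ ys)
          covered x (ds , valid , m) with sweeps (phi x) z≤n (component-in-arc valid phi-u≤M m)
          ... | x′ , m′ , phi≡ = visited-++ʳ u xs ys (subst (λ z → z ∈ visited (endpoint u xs) ys) (phi-injective x′ x phi≡) m′)

      upper : Σ (List Dir) λ ds → length ds ≡ M + L ⊓ R × Covers F u ds
      upper with L ≤? R
      ... | yes L≤R = replicate L ccw ++ replicate M cw , len ,
                      cover-by (replicate L ccw) (replicate M cw) (proj₁ to-left) (proj₁ sweep) sweeps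
        where
          e : Fin N
          e = endpoint u (replicate L ccw)
          phi-e : phi e ≡ 0
          phi-e = +-cancelʳ-≡ L (phi e) 0 (trans (proj₁ (proj₂ to-left)) phi-u)
          sweep : CwSweep M e
          sweep = cw-sweep M e (subst (λ z → z + M ≤ M) (sym phi-e) ≤-refl)
          sweeps : Sweeps e (replicate M cw) 0 M
          sweeps = subst₂ (Sweeps e (replicate M cw)) phi-e (cong (_+ M) phi-e) (proj₂ (proj₂ sweep))
          len : length (replicate L ccw ++ replicate M cw) ≡ M + L ⊓ R
          len = trans (length-++ (replicate L ccw)) (trans (cong₂ _+_ (length-replicate L) (length-replicate M))
                  (trans (+-comm L M) (cong (M +_) (sym (m≤n⇒m⊓n≡m L≤R)))))
      ... | no L≰R = replicate R cw ++ replicate M ccw , len ,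
                     cover-by (replicate R cw) (replicate M ccw) (proj₁ to-right) (proj₁ sweep) sweeps
        where
          e : Fin N
          e = endpoint u (replicate R cw)
          phi-e : phi e ≡ M
          phi-e = trans (proj₁ (proj₂ to-right)) M≡phi-u+R
          sweep : CcwSweep M e
          sweep = ccw-sweep M e (≤-reflexive (sym phi-e)) (≤-reflexive phi-e)
          sweeps : Sweeps e (replicate M ccw) 0 M
          sweeps = subst₂ (Sweeps e (replicate M ccw)) (trans (cong (_∸ M) phi-e) (n∸n≡0 M)) phi-e (proj₂ (proj₂ sweep))
          len : length (replicate R cw ++ replicate M ccw) ≡ M + L ⊓ R
          len = trans (length-++ (replicate R cw)) (trans (cong₂ _+_ (length-replicate R) (length-replicate M))
                  (trans (+-comm R M) (cong (M +_) (sym (m≥n⇒m⊓n≡n (<⇒≤ (≰⇒> L≰R)))))))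

      is-opt : IsOpt F u (M + L ⊓ R)
      is-opt = upper , lower

-- The fault-free execution of A from v on the ring of size k + 3, recorded as
-- a walk on ℕ started at K: up for clockwise moves, down for counterclockwise.
module FaultFree (k : ℕ) (A : Algorithm) (v : Fin (3 + k)) (K : ℕ) where

  F₀ : FaultConf (3 + k)
  F₀ _ = false

  P₀ : ℕ → Fin (3 + k)
  P₀ t = pos (run A F₀ v t)

  shift : Dir → ℕ → ℕ
  shift cw  x = suc x
  shift ccw x = pred x

  walk : ℕ → ℕ
  walk zero    = K
  walk (suc t) = shift (move-at A F₀ v t) (walk t)

  -- A trap for the fault-free walk is a fault configuration on which A has
  -- overhead at least p/q: cut the ring so that the component of v is the arc.
  module FromTrap {p q : ℕ} (tr : Trap walk K k p q) (ring≤K : 3 + k ≤ K) where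

    open Trap tr

    L≤K : L ≤ K
    L≤K = ≤-trans (≤-trans (m≤m+n L R) (n≤1+n _)) (≤-trans fits ring≤K)

    M : ℕ
    M = L + R

    c : ℕ
    c = (3 + k ∸ toℕ v) + L

    open Coordinate (2 + k) c
    open ArcFaults M (≤-pred fits)

    M≥1 : 1 ≤ M
    M≥1 = ≤-trans L≥1 (m≤m+n L R)

    phi-v : phi v ≡ L
    phi-v = begin
      (toℕ v + (N ∸ toℕ v + L)) % N   ≡⟨ cong (_% N) (+-assoc (toℕ v) _ L) ⟨
      (toℕ v + (N ∸ toℕ v) + L) % N   ≡⟨ cong (λ z → (z + L) % N) (m+[n∸m]≡n (<⇒≤ (toℕ<n v))) ⟩
      (N + L) % N                     ≡⟨ cong (_% N) (+-comm N L) ⟩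
      (L + N) % N                     ≡⟨ [m+n]%n≡m%n L N ⟩
      L % N                           ≡⟨ m<n⇒m%n≡m (<-≤-trans (s≤s (m≤m+n L R)) fits) ⟩
      L                               ∎
      where open ≡-Reasoning

    open Optimum v L R phi-v refl M≥1

    interior : ∀ x W → phi x + K ≡ W + L → K < W + L → W < K + R → 0 < phi x × phi x < M
    interior x W tracked left right = +-cancelʳ-≤ K 1 (phi x) (≤-trans left (≤-reflexive (sym tracked))) ,
      +-cancelʳ-≤ K (suc (phi x)) M (begin
        suc (phi x + K)  ≡⟨ cong suc tracked ⟩
        suc (W + L)      ≤⟨ +-monoˡ-≤ L right ⟩
        K + R + L        ≡⟨ regroup K R L ⟩
        L + R + K        ∎)
      where
        open ≤-Reasoning
        regroup : ∀ K R L → K + R + L ≡ L + R + K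
        regroup = solve-∀

    tracks-step : ∀ d x W → phi x + K ≡ W + L → K < W + L → W < K + R → phi (move x d) + K ≡ shift d W + L
    tracks-step cw x W tracked left right =
      trans (cong (_+ K) (phi-cw x (<⇒≢ (<-≤-trans (proj₂ (interior x W tracked left right)) (≤-pred fits))))) (cong suc tracked)
    tracks-step ccw x W tracked left right with phi x in phi≡
    ... | zero = ⊥-elim (<-irrefl refl (≤-trans left (≤-reflexive (sym tracked))))
    ... | suc y with W
    ...   | zero   = ⊥-elim (<-irrefl refl (≤-trans (s≤s (m≤n+m K y)) (≤-trans (≤-reflexive tracked) L≤K)))
    ...   | suc W′ = trans (cong (_+ K) (phi-ccw x y phi≡)) (suc-injective tracked)

    tracks : ∀ t → t ≤ K → (∀ t′ → t′ < t → Inside walk K L R t′) → phi (P₀ t) + K ≡ walk t + L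
    tracks zero    _     _      = trans (cong (_+ K) phi-v) (+-comm L K)
    tracks (suc t) 1+t≤K inside =
      trans (cong (λ x → phi x + K) (pos-suc A F₀ v t))
            (tracks-step (move-at A F₀ v t) (P₀ t) (walk t)
              (tracks t (<⇒≤ 1+t≤K) (λ t′ t′<t → inside t′ (<-trans t′<t (n<1+n t))))
              (proj₁ (inside t ≤-refl)) (proj₂ (inside t ≤-refl)))

    -- Until the walk reaches an end of the arc, the agent cannot distinguish F
    -- from the fault-free ring, and it stays strictly inside the arc.
    module Before (T : ℕ) (T≤K : T ≤ K) (inside : ∀ t → t < T → Inside walk K L R t) where

      interior₀ : ∀ t → t < T → 0 < phi (P₀ t) × phi (P₀ t) < M
      interior₀ t t<T = interior (P₀ t) (walk t) (tracks t (≤-trans (<⇒≤ t<T) T≤K) (λ t′ t′<t → inside t′ (<-trans t′<t t<T)))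
                          (proj₁ (inside t t<T)) (proj₂ (inside t t<T))

      same : Indistinguishable A F F₀ v T
      same t t<T = interior-looks-healthy (P₀ t) (proj₁ (interior₀ t t<T)) (proj₂ (interior₀ t t<T))

      interior-run : ∀ t → t < T → 0 < phi (pos (run A F v t)) × phi (pos (run A F v t)) < M
      interior-run t t<T = subst (λ s → 0 < phi (pos s) × phi (pos s) < M) (sym (same-run A F F₀ v T same t t<T)) (interior₀ t t<T)

      tracks-run : phi (pos (run A F v T)) + K ≡ walk T + L
      tracks-run = trans (cong (λ x → phi x + K) (same-pos A F F₀ v T same)) (tracks T T≤K inside)

    module Covering (k′ : ℕ) (valid : ValidWalk F v (runMoves A F v k′))
                    (covers : ∀ x → InC F v x → x ∈ visited v (runMoves A F v k′)) where
      z : ℕ → ℕ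
      z t = phi (pos (run A F v t))

      moves-healthy : ∀ t → t < k′ → z (suc t) ≤ suc (z t) × z t ≤ suc (z (suc t))
      moves-healthy t t<k′ = subst (λ x → phi x ≤ suc (z t) × z t ≤ suc (phi x)) (sym (pos-suc A F v t))
        (move-bounds (pos (run A F v t)) (move-at A F v t) (healthy-moves A F v k′ valid t t<k′))

      open Lipschitz z k′ (λ t t<k′ → proj₁ (moves-healthy t t<k′)) (λ t t<k′ → proj₂ (moves-healthy t t<k′))

      visit-left : Σ ℕ λ t → t ≤ k′ × pos (run A F v t) ≡ proj₁ left-end
      visit-left = visit-time A F v k′ (covers _ left-in-C)
      visit-right : Σ ℕ λ t → t ≤ k′ × pos (run A F v t) ≡ proj₁ right-end
      visit-right = visit-time A F v k′ (covers _ right-in-C)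
      t₀ tM : ℕ
      t₀ = proj₁ visit-left
      tM = proj₁ visit-right
      t₀≤k′ : t₀ ≤ k′
      t₀≤k′ = proj₁ (proj₂ visit-left)
      tM≤k′ : tM ≤ k′
      tM≤k′ = proj₁ (proj₂ visit-right)
      z-t₀ : z t₀ ≡ 0
      z-t₀ = trans (cong phi (proj₂ (proj₂ visit-left))) (proj₂ (proj₂ left-end))
      z-tM : z tM ≡ M
      z-tM = trans (cong phi (proj₂ (proj₂ visit-right))) (proj₂ (proj₂ right-end))

      late : ∀ {T} → T ≤ K → (∀ t → t < T → Inside walk K L R t) → T ≤ t₀ × T ≤ tM
      late T≤K inside = ≮⇒≥ (λ t₀<T → <-irrefl (sym z-t₀) (proj₁ (interior-run t₀ t₀<T))) ,
                        ≮⇒≥ (λ tM<T → <-irrefl z-tM (proj₂ (interior-run tM tM<T)))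
        where open Before _ T≤K inside

      from-forced : ForcedCost walk K L R B → B ≤ k′
      from-forced (stays-inside B≤K inside) = ≤-trans (proj₁ (late B≤K inside)) t₀≤k′
      from-forced (end-then-cross T T≤K inside at-end B≤) = ≤-trans B≤ (≤-trans (≤-reflexive (+-comm T M)) (crossing at-end))
        where
          open Before T T≤K inside
          crossing : AtEnd walk K L R T → M + T ≤ k′
          crossing (inj₁ at-right) = begin
            M + T        ≡⟨ cong (_+ T) z-T ⟨
            z T + T      ≤⟨ fall-bound (proj₁ (late T≤K inside)) t₀≤k′ ⟩
            z t₀ + t₀    ≡⟨ cong (_+ t₀) z-t₀ ⟩
            t₀           ≤⟨ t₀≤k′ ⟩
            k′           ∎
            where
              open ≤-Reasoning
              z-T : z T ≡ M
              z-T = +-cancelʳ-≡ K _ _ (trans tracks-run (trans (cong (_+ L) at-right) (regroup K R L)))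
                where regroup : ∀ K R L → K + R + L ≡ L + R + K
                      regroup = solve-∀
          crossing (inj₂ at-left) = begin
            M + T        ≡⟨ cong (_+ T) z-tM ⟨
            z tM + T     ≤⟨ rise-bound (proj₂ (late T≤K inside)) tM≤k′ ⟩
            z T + tM     ≡⟨ cong (_+ tM) z-T ⟩
            tM           ≤⟨ tM≤k′ ⟩
            k′           ∎
            where
              open ≤-Reasoning
              z-T : z T ≡ 0
              z-T = +-cancelʳ-≡ K _ 0 (trans tracks-run at-left)

    forced-cost : ∀ k′ → Covers F v (runMoves A F v k′) → B ≤ k′
    forced-cost k′ (valid , covers) = Covering.from-forced k′ valid covers forced

    overhead : OverheadAtLeast v A p q
    overhead = F , M + L ⊓ R , is-opt , ≤-trans M≥1 (m≤m+n M (L ⊓ R)) ,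
               λ k′ covering → ≤-trans ratio (*-monoʳ-≤ q (forced-cost k′ covering))

-- The adversary applied to the fault-free walk of A (reflected if A starts
-- counterclockwise) gives the lower bound p/q for every admissible rate.
module _ (k : ℕ) (A : Algorithm) (v : Fin (3 + k)) where

  K : ℕ
  K = k + k + k + k + 12

  open FaultFree k A v K

  -- K exceeds the ring size and leaves room for the adversary's arithmetic
  ring≤K : 3 + k ≤ K
  ring≤K = ≤-trans (m≤n+m (3 + k) (k + k + k + 9)) (≤-reflexive (regroup k))
    where regroup : ∀ k → k + k + k + 9 + (3 + k) ≡ k + k + k + k + 12
          regroup = solve-∀

  K-large : k + k + k + k + 8 ≤ K
  K-large = +-monoʳ-≤ (k + k + k + k) (m≤m+n 8 4)

  walk-above : ∀ t → K ≤ walk t + t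
  walk-above zero    = ≤-reflexive (sym (+-identityʳ K))
  walk-above (suc t) = ≤-trans (walk-above t) (≤-trans (+-monoˡ-≤ t (down (move-at A F₀ v t) (walk t)))
                                 (≤-reflexive (sym (+-suc (walk (suc t)) t))))
    where down : ∀ d x → x ≤ suc (shift d x)
          down cw      x = ≤-trans (n≤1+n x) (n≤1+n (suc x))
          down ccw zero    = z≤n
          down ccw (suc x) = ≤-refl

  walk-below : ∀ t → walk t ≤ K + t
  walk-below zero    = ≤-reflexive (sym (+-identityʳ K))
  walk-below (suc t) = ≤-trans (up (move-at A F₀ v t) (walk t)) (≤-trans (s≤s (walk-below t)) (≤-reflexive (sym (+-suc K t))))
    where up : ∀ d x → shift d x ≤ suc x
          up cw      x = ≤-refl
          up ccw zero    = z≤n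
          up ccw (suc x) = ≤-trans (n≤1+n x) (n≤1+n (suc x))

  -- during its first K steps the walk stays positive, so every step moves it by one
  walk-unit : UnitSteps walk K
  walk-unit t t<K with move-at A F₀ v t | walk t in walk≡
  ... | cw  | _     = inj₁ refl
  ... | ccw | suc x = inj₂ refl
  ... | ccw | zero  = ⊥-elim (<-irrefl refl (<-≤-trans t<K (subst (λ x → K ≤ x + t) walk≡ (walk-above t))))

  mirrored : ℕ → ℕ
  mirrored t = (K + K) ∸ walk t

  walk≤2K : ∀ t → t ≤ K → walk t ≤ K + K
  walk≤2K t t≤K = ≤-trans (walk-below t) (+-monoʳ-≤ K t≤K)

  reflect : ∀ t → t ≤ K → walk t + mirrored t ≡ K + K
  reflect t t≤K = m+[n∸m]≡n (walk≤2K t t≤K)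

  mirrored-unit : UnitSteps mirrored K
  mirrored-unit t t<K with walk-unit t t<K
  ... | inj₁ up   = inj₂ (begin
    suc (K + K ∸ walk (suc t))     ≡⟨ +-∸-assoc 1 (walk≤2K (suc t) t<K) ⟨
    suc (K + K) ∸ walk (suc t)     ≡⟨ cong (suc (K + K) ∸_) up ⟩
    K + K ∸ walk t                 ∎)
    where open ≡-Reasoning
  ... | inj₂ down = inj₁ (begin
    K + K ∸ walk (suc t)           ≡⟨ cong (suc (K + K) ∸_) down ⟩
    suc (K + K) ∸ walk t           ≡⟨ +-∸-assoc 1 (walk≤2K t (<⇒≤ t<K)) ⟩
    suc (K + K ∸ walk t)           ∎)
    where open ≡-Reasoning

  rate-lower-bound : ∀ {p q} → Rate k p q → OverheadAtLeast v A p q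
  rate-lower-bound rate with move-at A F₀ v 0 in first
  ... | cw  = FromTrap.overhead (Adversary.adversary walk K walk-unit refl (cong (λ d → shift d K) first) K-large rate) ring≤K
  ... | ccw = FromTrap.overhead (Mirror.trap-mirror walk mirrored K reflect
                (Adversary.adversary mirrored K mirrored-unit (m+n∸n≡m K K) mirrored-1 K-large rate)) ring≤K
    where
      mirrored-1 : mirrored 1 ≡ suc K
      mirrored-1 = trans (cong (λ d → K + K ∸ shift d K) first) (reflect-pred K (≤-trans (s≤s z≤n) ring≤K))
        where
          reflect-pred : ∀ K → 1 ≤ K → K + K ∸ pred K ≡ suc K
          reflect-pred (suc K₀) _ = trans (cong (_∸ K₀) (regroup K₀)) (m+n∸m≡n K₀ (suc (suc K₀)))
            where regroup : ∀ x → suc x + suc x ≡ x + suc (suc x)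
                  regroup = solve-∀

≤-by-evaluation : ∀ {m n} → {evidence : True (m ≤? n)} → m ≤ n
≤-by-evaluation {evidence = evidence} = toWitness evidence

≤-by-slack : ∀ {x y} d → x + d ≡ y → x ≤ y
≤-by-slack {x} d refl = m≤m+n x d

for-1-and-2 : {P : ℕ → Set} → P 1 → P 2 → ∀ a → 1 ≤ a → a ≤ 2 → P a
for-1-and-2 p₁ p₂ 1 _ _ = p₁
for-1-and-2 p₁ p₂ 2 _ _ = p₂
for-1-and-2 p₁ p₂ (suc (suc (suc a))) _ (s≤s (s≤s ()))

-- Small rates are already forced by round one.
round-one-rate : ∀ {k} p q → p ≤ q + q → p * (k + 3) ≤ q * (k + k + 3) → p * 4 ≤ q * 6 → p * 5 ≤ q * 9 → Rate k p q
round-one-rate p q p≤2q first a=1 a=2 = record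
  { at-most-two = p≤2q ; first-round = first ; short-turn = for-1-and-2 (inj₁ a=1) (inj₁ a=2) }

-- (2n - 2)/(n + 1) for the ring of size n = k + 3 with 5 ≤ k ≤ 16.
middle-rate : ∀ k → 5 ≤ k → k ≤ 16 → Rate k (k + k + 4) (k + 4)
middle-rate k k≥5 k≤16 = record
  { at-most-two = ≤-by-slack 4 (ring₁ k)
  ; first-round = ≤-by-slack k (ring₂ k)
  ; short-turn  = for-1-and-2 (inj₂ long) (inj₁ a=2) }
  where
    ring₁ : ∀ k → k + k + 4 + 4 ≡ k + 4 + (k + 4)
    ring₁ = solve-∀
    ring₂ : ∀ k → (k + k + 4) * (k + 3) + k ≡ (k + 4) * (k + k + 3)
    ring₂ = solve-∀
    ring₃ : ∀ k → (k + k + 4) * (k + 3 + 1) ≡ (k + 4) * (k + k + 1 + 3)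
    ring₃ = solve-∀
    ring₄ : ∀ k → (k + k + 4) * (k + 3 + 1) + (k + k + 8) ≡ (k + 4) * (k + k + 1 + 5)
    ring₄ = solve-∀
    ring₅ : ∀ k → (k + k + 4) * (k + 3 + 2) + (k + 8) ≡ (k + 4) * (k + k + 2 + 5)
    ring₅ = solve-∀
    ring₆ : ∀ k → (k + k + 4) * (1 + 1 + 3) ≡ k + (9 * k + 20)
    ring₆ = solve-∀
    ring₇ : ∀ k → 16 + (9 * k + 20) ≡ (k + 4) * (1 + 1 + 1 + 1 + 1 + 1 + 3)
    ring₇ = solve-∀
    long : LongGame k (k + k + 4) (k + 4) 1
    long = record
      { room = k≥5 ; second = ≤-reflexive (ring₃ k)
      ; third = for-1-and-2 (≤-by-slack (k + k + 8) (ring₄ k)) (≤-by-slack (k + 8) (ring₅ k)) }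
    -- a second excursion of length 2 is cheap only while k ≤ 16
    a=2 : (k + k + 4) * (2 + 3) ≤ (k + 4) * (2 + 2 + 2 + 3)
    a=2 = subst₂ _≤_ (sym (ring₆ k)) (ring₇ k) (+-monoˡ-≤ (9 * k + 20) k≤16)

-- 9/5 for the ring of size n = k + 3 with k ≥ 17.
nine-fifths : ∀ k → 17 ≤ k → Rate k 9 5
nine-fifths k k≥17 = record
  { at-most-two = ≤-by-evaluation
  ; first-round = bound 12 (9 * k + 15) (ring₁ k) (ring₂ k)
  ; short-turn  = for-1-and-2 (inj₂ long) (inj₁ ≤-by-evaluation) }
  where
    bound : ∀ c W {X Y} → X ≡ c + W → k + W ≡ Y → {True (c ≤? 17)} → X ≤ Y
    bound c W refl refl {c≤17} = +-monoˡ-≤ W (≤-trans (toWitness c≤17) k≥17)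
    ring₁ : ∀ k → 9 * (k + 3) ≡ 12 + (9 * k + 15)
    ring₁ = solve-∀
    ring₂ : ∀ k → k + (9 * k + 15) ≡ 5 * (k + k + 3)
    ring₂ = solve-∀
    ring₃ : ∀ k → 9 * (k + 3 + 1) ≡ 16 + (9 * k + 20)
    ring₃ = solve-∀
    ring₄ : ∀ k → k + (9 * k + 20) ≡ 5 * (k + k + 1 + 3)
    ring₄ = solve-∀
    ring₅ : ∀ k → 9 * (k + 3 + 1) ≡ 6 + (9 * k + 30)
    ring₅ = solve-∀
    ring₆ : ∀ k → k + (9 * k + 30) ≡ 5 * (k + k + 1 + 5)
    ring₆ = solve-∀
    ring₇ : ∀ k → 9 * (k + 3 + 2) ≡ 10 + (9 * k + 35)
    ring₇ = solve-∀
    ring₈ : ∀ k → k + (9 * k + 35) ≡ 5 * (k + k + 2 + 5)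
    ring₈ = solve-∀
    long : LongGame k 9 5 1
    long = record
      { room = ≤-trans ≤-by-evaluation k≥17 ; second = bound 16 (9 * k + 20) (ring₃ k) (ring₄ k)
      ; third = for-1-and-2 (bound 6 (9 * k + 30) (ring₅ k) (ring₆ k)) (bound 10 (9 * k + 35) (ring₇ k) (ring₈ k)) }

-- (2n - 1)/(n + 2) for the ring of size n = k + 3 with k ≥ 5.
large-rate : ∀ k → 5 ≤ k → Rate k (k + k + 5) (k + 5)
large-rate k k≥5 = record
  { at-most-two = ≤-by-slack 5 (ring₁ k)
  ; first-round = ≤-by-slack (k + k) (ring₂ k)
  ; short-turn  = for-1-and-2 (inj₂ (long (≤-by-slack k (ring₃ k))))
                              (inj₂ (long (≤-reflexive (ring₄ k)))) }
  where
    ring₁ : ∀ k → k + k + 5 + 5 ≡ k + 5 + (k + 5)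
    ring₁ = solve-∀
    ring₂ : ∀ k → (k + k + 5) * (k + 3) + (k + k) ≡ (k + 5) * (k + k + 3)
    ring₂ = solve-∀
    ring₃ : ∀ k → (k + k + 5) * (k + 3 + 1) + k ≡ (k + 5) * (k + k + 1 + 3)
    ring₃ = solve-∀
    ring₄ : ∀ k → (k + k + 5) * (k + 3 + 2) ≡ (k + 5) * (k + k + 2 + 3)
    ring₄ = solve-∀
    ring₅ : ∀ k → (k + k + 5) * (k + 3 + 1) + (k + k + k + 10) ≡ (k + 5) * (k + k + 1 + 5)
    ring₅ = solve-∀
    ring₆ : ∀ k → (k + k + 5) * (k + 3 + 2) + (k + k + 10) ≡ (k + 5) * (k + k + 2 + 5)
    ring₆ = solve-∀
    long : ∀ {a} → (k + k + 5) * (k + 3 + a) ≤ (k + 5) * (k + k + a + 3) → LongGame k (k + k + 5) (k + 5) a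
    long second = record
      { room = k≥5 ; second = second
      ; third = for-1-and-2 (≤-by-slack (k + k + k + 10) (ring₅ k)) (≤-by-slack (k + k + 10) (ring₆ k)) }

sizes-4-5 : ∀ k → 1 ≤ k → k ≤ 2 → (v : Fin (3 + k)) (A : Algorithm) → OverheadAtLeast v A (2 * (3 + k) ∸ 3) (3 + k)
sizes-4-5 1 _ _ v A = rate-lower-bound 1 A v (round-one-rate 5 4 ≤-by-evaluation ≤-by-evaluation ≤-by-evaluation ≤-by-evaluation)
sizes-4-5 2 _ _ v A = rate-lower-bound 2 A v (round-one-rate 7 5 ≤-by-evaluation ≤-by-evaluation ≤-by-evaluation ≤-by-evaluation)
sizes-4-5 (suc (suc (suc _))) _ (s≤s (s≤s ())) v A

sizes-6-7 : ∀ k → 3 ≤ k → k ≤ 4 → (v : Fin (3 + k)) (A : Algorithm) → OverheadAtLeast v A 3 2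
sizes-6-7 3 _ _ v A = rate-lower-bound 3 A v (round-one-rate 3 2 ≤-by-evaluation ≤-by-evaluation ≤-by-evaluation ≤-by-evaluation)
sizes-6-7 4 _ _ v A = rate-lower-bound 4 A v (round-one-rate 3 2 ≤-by-evaluation ≤-by-evaluation ≤-by-evaluation ≤-by-evaluation)
sizes-6-7 0 () _ v A
sizes-6-7 1 (s≤s ()) _ v A
sizes-6-7 2 (s≤s (s≤s ())) _ v A
sizes-6-7 (suc (suc (suc (suc (suc _))))) _ (s≤s (s≤s (s≤s (s≤s ())))) v A

too-small : ∀ {n c} {X : Set} → n ≤ 2 → 3 + c ≤ n → X
too-small n≤2 n≥3+c = ⊥-elim (≤⇒≯ n≤2 (≤-trans (s≤s (s≤s (s≤s z≤n))) n≥3+c))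

proposition2p2 : (n : ℕ) → .{{_ : NonZero n}} → (v : Fin n) → (A : Algorithm) →
    ((4 ≤ n → n ≤ 5 → OverheadAtLeast v A (2 * n ∸ 3) n)
    × (6 ≤ n → n ≤ 7 → OverheadAtLeast v A 3 2)
    × (8 ≤ n → n ≤ 19 → OverheadAtLeast v A (2 * n ∸ 2) (n + 1))
    × (20 ≤ n → n ≤ 23 → OverheadAtLeast v A 9 5)
    × (24 ≤ n → OverheadAtLeast v A (2 * n ∸ 1) (n + 2)))
proposition2p2 1 v A =
  (λ h _ → too-small 1≤2 h) , (λ h _ → too-small 1≤2 h) , (λ h _ → too-small 1≤2 h) , (λ h _ → too-small 1≤2 h) , too-small 1≤2
  where 1≤2 : 1 ≤ 2
        1≤2 = s≤s z≤n
proposition2p2 2 v A =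
  (λ h _ → too-small ≤-refl h) , (λ h _ → too-small ≤-refl h) , (λ h _ → too-small ≤-refl h) , (λ h _ → too-small ≤-refl h) , too-small ≤-refl
proposition2p2 (suc (suc (suc k))) v A =
  (λ n≥4 n≤5 → sizes-4-5 k (≤-pred³ n≥4) (≤-pred³ n≤5) v A) ,
  (λ n≥6 n≤7 → sizes-6-7 k (≤-pred³ n≥6) (≤-pred³ n≤7) v A) ,
  (λ n≥8 n≤19 → subst₂ (OverheadAtLeast v A) (sym (2n-2 k)) (sym (n+1 k))
                  (rate-lower-bound k A v (middle-rate k (≤-pred³ n≥8) (≤-pred³ n≤19)))) ,
  (λ n≥20 _ → rate-lower-bound k A v (nine-fifths k (≤-pred³ n≥20))) ,
  (λ n≥24 → subst₂ (OverheadAtLeast v A) (sym (2n-1 k)) (sym (n+2 k))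
              (rate-lower-bound k A v (large-rate k (≤-trans ≤-by-evaluation (≤-pred³ n≥24)))))
  where
    ≤-pred³ : ∀ {a b} → 3 + a ≤ 3 + b → a ≤ b
    ≤-pred³ = ≤-pred ∘ ≤-pred ∘ ≤-pred
    -- the left-hand sides are 2 * (3 + k) ∸ 2 and 2 * (3 + k) ∸ 1 after evaluation
    2n-2 : ∀ k → suc k + (3 + k + 0) ≡ k + k + 4
    2n-2 = solve-∀
    2n-1 : ∀ k → suc (suc k) + (3 + k + 0) ≡ k + k + 5
    2n-1 = solve-∀
    n+1 : ∀ k → 3 + k + 1 ≡ k + 4
    n+1 = solve-∀
    n+2 : ∀ k → 3 + k + 2 ≡ k + 5
    n+2 = solve-∀
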